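{- If $m$ and $n$ are integers with $m\geq 12$ and $n\geq 12$, then $M(m, n)\leq 9$.
   Context: The $T$-tetromino is the polyomino formed by four unit squares: three in a row together with a fourth square attached to the middle square of that row. A tiling of an $m\times n$ rectangle (of unit cells) by $T$-tetrominos and monominos is a partition of its cells into copies of the $T$-tetromino (in any rotation or reflection, aligned with the grid) and single cells (monominos). The gap number $M(m,n)$ is the least number of monominos occurring in such a tiling of the $m\times n$ rectangle. -}

module Defs where

open import Data.Nat using (ℕ; suc; _+_; _*_; _≤_)
open import Data.Product using (_×_; _,_; ∃-syntax)
open import Data.List using (List; []; _∷_; map; concatMap; length; filter; upTo; cartesianProduct)
open import Data.List.Relation.Binary.Permutation.Propositional using (_↭_)

-- A cell of the grid: (row , column), both natural numbers.
Cell : Set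
Cell = ℕ × ℕ

rectangle : ℕ → ℕ → List Cell
rectangle m n = cartesianProduct (upTo m) (upTo n)

-- The four orientations of the T-tetromino (reflections of a T coincide
-- with rotations, so these are all placements up to translation).
data Orientation : Set where
  stemDown stemUp stemRight stemLeft : Orientation

-- A piece of a tiling: a T-tetromino given by its orientation and the
-- top-left corner (a , b) of its bounding box, or a monomino at a cell.
data Piece : Set where
  tee  : Orientation → ℕ → ℕ → Piece
  mono : ℕ → ℕ → Piece

cells : Piece → List Cell
cells (tee stemDown  a b) = (a , b) ∷ (a , suc b) ∷ (a , suc (suc b)) ∷ (suc a , suc b) ∷ []
cells (tee stemUp    a b) = (suc a , b) ∷ (suc a , suc b) ∷ (suc a , suc (suc b)) ∷ (a , suc b) ∷ []
cells (tee stemRight a b) = (a , b) ∷ (suc a , b) ∷ (suc (suc a) , b) ∷ (suc a , suc b) ∷ []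
cells (tee stemLeft  a b) = (a , suc b) ∷ (suc a , suc b) ∷ (suc (suc a) , suc b) ∷ (suc a , b) ∷ []
cells (mono a b) = (a , b) ∷ []

-- A list of pieces tiles the m × n rectangle iff the multiset of all cells
-- covered by the pieces is exactly the multiset of cells of the rectangle,
-- i.e. the pieces partition the rectangle's cells.
Tiles : ℕ → ℕ → List Piece → Set
Tiles m n ps = concatMap cells ps ↭ rectangle m n

monoCount : List Piece → ℕ
monoCount [] = 0
monoCount (tee _ _ _ ∷ ps) = monoCount ps
monoCount (mono _ _ ∷ ps) = suc (monoCount ps)

-- "M(m,n) ≤ k": some tiling of the m × n rectangle by T-tetrominos and
-- monominos uses at most k monominos (M is the least such number).
GapAtMost : ℕ → ℕ → ℕ → Set
GapAtMost m n k = ∃[ ps ] (Tiles m n ps × monoCount ps ≤ k)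

module Submission where

-- For m, n ≥ 12 an m × n rectangle splits, according to the residues of m and n modulo 4, into
-- a block of 4 × 4 squares, each tiled by four T-tetrominoes, and at most two strips of height
-- 6, 13 or 15 whose lengths run through arithmetic progressions. Each strip is tiled periodically:
-- a fixed left end, a monomino-free brick repeated with period 4 or 16 that interlocks with its
-- neighbours, and one of finitely many right ends. Such a strip needs at most 5 monominoes, and
-- the strips of one rectangle need at most 9 together. The finitely many tilings involved are
-- verified by sorting their cell lists.

open import Defs
open import Level using (Level)
open import Data.Nat using (ℕ; zero; suc; _+_; _*_; _∸_; _≤_; _≤?_; z≤n)
open import Data.Nat.Properties
  using ( +-suc; +-assoc; +-comm; +-identityʳ; *-assoc; +-mono-≤; ≤-trans; ≤-refl; ≤-reflexive
        ; ≤-decTotalOrder; m+[n∸m]≡n)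
open import Data.Product using (_,_; swap)
import Data.Product as Product
open import Data.Product.Relation.Binary.Lex.NonStrict using (×-decTotalOrder)
open import Data.List using (List; []; _∷_; _++_; map; concatMap; cartesianProduct; upTo; applyUpTo)
open import Data.List.Properties
  using ( ++-assoc; map-++; map-∘; map-cong; map-id; map-applyUpTo; concatMap-++; concatMap-map
        ; concatMap-cong; map-concatMap; cartesianProductWith-distribʳ-++; cartesianProductWith-zeroʳ)
open import Data.List.Relation.Binary.Permutation.Propositional
  using (_↭_; prep; ↭-refl; ↭-sym; ↭-trans; ↭-reflexive; module PermutationReasoning)
open import Data.List.Relation.Binary.Permutation.Propositional.Properties
  using (++⁺; ++⁺ˡ; ++⁺ʳ; ++-comm; shifts; map⁺)
open import Data.List.Sort.MergeSort.Base (×-decTotalOrder ≤-decTotalOrder ≤-decTotalOrder) using (sort)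
open import Data.List.Sort.MergeSort.Properties (×-decTotalOrder ≤-decTotalOrder ≤-decTotalOrder) using (sort-↭)
open import Relation.Nullary.Decidable using (True; toWitness)
open import Relation.Binary.PropositionalEquality
  using (_≡_; refl; sym; trans; cong; cong₂; subst; subst₂; module ≡-Reasoning)

private
  variable
    a b c d : Level
    A : Set a
    B : Set b
    C : Set c
    D : Set d

interval : ℕ → ℕ → List ℕ
interval x zero    = []
interval x (suc n) = x ∷ interval (suc x) n

interval-++ : ∀ x m n → interval x (m + n) ≡ interval x m ++ interval (x + m) n
interval-++ x zero    n = cong (λ y → interval y n) (sym (+-identityʳ x))
interval-++ x (suc m) n = cong (x ∷_) (begin
  interval (suc x) (m + n)
    ≡⟨ interval-++ (suc x) m n ⟩
  interval (suc x) m ++ interval (suc x + m) n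
    ≡⟨ cong (λ y → interval (suc x) m ++ interval y n) (+-suc x m) ⟨
  interval (suc x) m ++ interval (x + suc m) n ∎)
  where open ≡-Reasoning

map-+-interval : ∀ i x n → map (_+ i) (interval x n) ≡ interval (x + i) n
map-+-interval i x zero    = refl
map-+-interval i x (suc n) = cong (x + i ∷_) (map-+-interval i (suc x) n)

upTo≡interval : ∀ n → upTo n ≡ interval 0 n
upTo≡interval zero    = refl
upTo≡interval (suc n) = cong (0 ∷_) (begin
  applyUpTo suc n            ≡⟨ map-applyUpTo (λ i → i) suc n ⟨
  map suc (upTo n)           ≡⟨ cong (map suc) (upTo≡interval n) ⟩
  map suc (interval 0 n)     ≡⟨ map-suc n 0 ⟩
  interval 1 n               ∎)
  where
  open ≡-Reasoning
  map-suc : ∀ n x → map suc (interval x n) ≡ interval (suc x) n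
  map-suc zero    x = refl
  map-suc (suc n) x = cong (suc x ∷_) (map-suc n (suc x))

++-interchange : ∀ (ws xs ys zs : List A) → (ws ++ xs) ++ (ys ++ zs) ↭ (ws ++ ys) ++ (xs ++ zs)
++-interchange ws xs ys zs = begin
  (ws ++ xs) ++ (ys ++ zs)  ≡⟨ ++-assoc ws xs (ys ++ zs) ⟩
  ws ++ (xs ++ ys ++ zs)    ↭⟨ ++⁺ˡ ws (shifts xs ys) ⟩
  ws ++ (ys ++ xs ++ zs)    ≡⟨ ++-assoc ws ys (xs ++ zs) ⟨
  (ws ++ ys) ++ (xs ++ zs)  ∎
  where open PermutationReasoning


cartesianProduct-distribˡ-++ : ∀ (xs : List A) (ys zs : List B) →
  cartesianProduct xs (ys ++ zs) ↭ cartesianProduct xs ys ++ cartesianProduct xs zs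
cartesianProduct-distribˡ-++ []       ys zs = ↭-refl
cartesianProduct-distribˡ-++ (x ∷ xs) ys zs = begin
  map (x ,_) (ys ++ zs) ++ cartesianProduct xs (ys ++ zs)
    ≡⟨ cong (_++ cartesianProduct xs (ys ++ zs)) (map-++ (x ,_) ys zs) ⟩
  (map (x ,_) ys ++ map (x ,_) zs) ++ cartesianProduct xs (ys ++ zs)
    ↭⟨ ++⁺ˡ (map (x ,_) ys ++ map (x ,_) zs) (cartesianProduct-distribˡ-++ xs ys zs) ⟩
  (map (x ,_) ys ++ map (x ,_) zs) ++ (cartesianProduct xs ys ++ cartesianProduct xs zs)
    ↭⟨ ++-interchange (map (x ,_) ys) (map (x ,_) zs) (cartesianProduct xs ys) (cartesianProduct xs zs) ⟩
  (map (x ,_) ys ++ cartesianProduct xs ys) ++ (map (x ,_) zs ++ cartesianProduct xs zs) ∎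
  where open PermutationReasoning

cartesianProduct-∷ʳ : ∀ (xs : List A) (y : B) (ys : List B) →
  cartesianProduct xs (y ∷ ys) ↭ map (_, y) xs ++ cartesianProduct xs ys
cartesianProduct-∷ʳ []       y ys = ↭-refl
cartesianProduct-∷ʳ (x ∷ xs) y ys =
  prep (x , y) (↭-trans (++⁺ˡ (map (x ,_) ys) (cartesianProduct-∷ʳ xs y ys))
                        (shifts (map (x ,_) ys) (map (_, y) xs)))

map-swap-cartesianProduct : ∀ (xs : List A) (ys : List B) →
  map swap (cartesianProduct xs ys) ↭ cartesianProduct ys xs
map-swap-cartesianProduct []       ys = ↭-reflexive (sym (cartesianProductWith-zeroʳ _,_ ys))
map-swap-cartesianProduct (x ∷ xs) ys = begin
  map swap (map (x ,_) ys ++ cartesianProduct xs ys)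
    ≡⟨ map-++ swap (map (x ,_) ys) (cartesianProduct xs ys) ⟩
  map swap (map (x ,_) ys) ++ map swap (cartesianProduct xs ys)
    ≡⟨ cong (_++ map swap (cartesianProduct xs ys)) (map-∘ ys) ⟨
  map (_, x) ys ++ map swap (cartesianProduct xs ys)
    ↭⟨ ++⁺ˡ (map (_, x) ys) (map-swap-cartesianProduct xs ys) ⟩
  map (_, x) ys ++ cartesianProduct ys xs
    ↭⟨ cartesianProduct-∷ʳ ys x xs ⟨
  cartesianProduct ys (x ∷ xs) ∎
  where open PermutationReasoning

map-cartesianProduct : (f : A → C) (g : B → D) (xs : List A) (ys : List B) →
  map (Product.map f g) (cartesianProduct xs ys) ≡ cartesianProduct (map f xs) (map g ys)
map-cartesianProduct f g []       ys = refl
map-cartesianProduct f g (x ∷ xs) ys = begin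
  map (Product.map f g) (map (x ,_) ys ++ cartesianProduct xs ys)
    ≡⟨ map-++ (Product.map f g) (map (x ,_) ys) (cartesianProduct xs ys) ⟩
  map (Product.map f g) (map (x ,_) ys) ++ map (Product.map f g) (cartesianProduct xs ys)
    ≡⟨ cong₂ _++_ (trans (sym (map-∘ ys)) (map-∘ ys)) (map-cartesianProduct f g xs ys) ⟩
  map (f x ,_) (map g ys) ++ cartesianProduct (map f xs) (map g ys) ∎
  where open ≡-Reasoning

block : ℕ → ℕ → ℕ → ℕ → List Cell
block x y h w = cartesianProduct (interval x h) (interval y w)

rectangle≡block : ∀ h w → rectangle h w ≡ block 0 0 h w
rectangle≡block h w = cong₂ cartesianProduct (upTo≡interval h) (upTo≡interval w)

block-zeroʷ : ∀ x y h → block x y h 0 ≡ []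
block-zeroʷ x y h = cartesianProductWith-zeroʳ _,_ (interval x h)

block-+ʰ : ∀ x y h₁ h₂ w → block x y (h₁ + h₂) w ≡ block x y h₁ w ++ block (x + h₁) y h₂ w
block-+ʰ x y h₁ h₂ w =
  trans (cong (λ xs → cartesianProduct xs (interval y w)) (interval-++ x h₁ h₂))
        (cartesianProductWith-distribʳ-++ _,_ (interval x h₁) (interval (x + h₁) h₂) (interval y w))

block-+ʷ : ∀ x y h w₁ w₂ → block x y h (w₁ + w₂) ↭ block x y h w₁ ++ block x (y + w₁) h w₂
block-+ʷ x y h w₁ w₂ =
  ↭-trans (↭-reflexive (cong (cartesianProduct (interval x h)) (interval-++ y w₁ w₂)))
          (cartesianProduct-distribˡ-++ (interval x h) (interval y w₁) (interval (y + w₁) w₂))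

translate : ℕ → ℕ → Cell → Cell
translate i j = Product.map (_+ i) (_+ j)

map-translate-block : ∀ i j x y h w → map (translate i j) (block x y h w) ≡ block (x + i) (y + j) h w
map-translate-block i j x y h w =
  trans (map-cartesianProduct (_+ i) (_+ j) (interval x h) (interval y w))
        (cong₂ cartesianProduct (map-+-interval i x h) (map-+-interval j y w))

map-swap-block : ∀ x y h w → map swap (block x y h w) ↭ block y x w h
map-swap-block x y h w = map-swap-cartesianProduct (interval x h) (interval y w)

map-translate-translate : ∀ i j i′ j′ cs →
  map (translate i j) (map (translate i′ j′) cs) ≡ map (translate (i′ + i) (j′ + j)) cs
map-translate-translate i j i′ j′ cs =
  trans (sym (map-∘ cs)) (map-cong (λ { (a , b) → cong₂ _,_ (+-assoc a i′ i) (+-assoc b j′ j) }) cs)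

map-translate-zero : ∀ cs → map (translate 0 0) cs ≡ cs
map-translate-zero cs =
  trans (map-cong (λ { (a , b) → cong₂ _,_ (+-identityʳ a) (+-identityʳ b) }) cs) (map-id cs)

translatePiece : ℕ → ℕ → Piece → Piece
translatePiece i j (tee o a b) = tee o (a + i) (b + j)
translatePiece i j (mono a b)  = mono (a + i) (b + j)

cells-translatePiece : ∀ i j p → cells (translatePiece i j p) ≡ map (translate i j) (cells p)
cells-translatePiece i j (tee stemDown a b)  = refl
cells-translatePiece i j (tee stemUp a b)    = refl
cells-translatePiece i j (tee stemRight a b) = refl
cells-translatePiece i j (tee stemLeft a b)  = refl
cells-translatePiece i j (mono a b)          = refl

transposeOrientation : Orientation → Orientation
transposeOrientation stemDown  = stemRight
transposeOrientation stemUp    = stemLeft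
transposeOrientation stemRight = stemDown
transposeOrientation stemLeft  = stemUp

transposePiece : Piece → Piece
transposePiece (tee o a b) = tee (transposeOrientation o) b a
transposePiece (mono a b)  = mono b a

cells-transposePiece : ∀ p → cells (transposePiece p) ≡ map swap (cells p)
cells-transposePiece (tee stemDown a b)  = refl
cells-transposePiece (tee stemUp a b)    = refl
cells-transposePiece (tee stemRight a b) = refl
cells-transposePiece (tee stemLeft a b)  = refl
cells-transposePiece (mono a b)          = refl

cellsOf : List Piece → List Cell
cellsOf = concatMap cells

cellsOf-map : ∀ {f : Piece → Piece} {g : Cell → Cell} →
  (∀ p → cells (f p) ≡ map g (cells p)) → ∀ ps → cellsOf (map f ps) ≡ map g (cellsOf ps)
cellsOf-map {f} {g} cells-f ps = begin
  cellsOf (map f ps)                   ≡⟨ concatMap-map cells f ps ⟩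
  concatMap (λ p → cells (f p)) ps     ≡⟨ concatMap-cong cells-f ps ⟩
  concatMap (λ p → map g (cells p)) ps ≡⟨ map-concatMap g cells ps ⟨
  map g (cellsOf ps)                   ∎
  where open ≡-Reasoning

monoCount-++ : ∀ ps qs → monoCount (ps ++ qs) ≡ monoCount ps + monoCount qs
monoCount-++ []               qs = refl
monoCount-++ (tee _ _ _ ∷ ps) qs = monoCount-++ ps qs
monoCount-++ (mono _ _ ∷ ps)  qs = cong suc (monoCount-++ ps qs)

monoCount-map : ∀ {f : Piece → Piece} →
  (∀ p → monoCount (f p ∷ []) ≡ monoCount (p ∷ [])) → ∀ ps → monoCount (map f ps) ≡ monoCount ps
monoCount-map         f-shape []       = refl
monoCount-map {f = f} f-shape (p ∷ ps) = begin
  monoCount (f p ∷ map f ps)                  ≡⟨ monoCount-++ (f p ∷ []) (map f ps) ⟩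
  monoCount (f p ∷ []) + monoCount (map f ps) ≡⟨ cong₂ _+_ (f-shape p) (monoCount-map f-shape ps) ⟩
  monoCount (p ∷ []) + monoCount ps           ≡⟨ monoCount-++ (p ∷ []) ps ⟨
  monoCount (p ∷ ps)                          ∎
  where open ≡-Reasoning

monoCount-translatePiece : ∀ i j ps → monoCount (map (translatePiece i j) ps) ≡ monoCount ps
monoCount-translatePiece i j = monoCount-map λ { (tee _ _ _) → refl ; (mono _ _) → refl }

monoCount-transposePiece : ∀ ps → monoCount (map transposePiece ps) ≡ monoCount ps
monoCount-transposePiece = monoCount-map λ { (tee _ _ _) → refl ; (mono _ _) → refl }

record Tiling (h w c : ℕ) : Set where
  constructor tiling
  field
    pieces   : List Piece
    covers   : cellsOf pieces ↭ block 0 0 h w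
    fewMonos : monoCount pieces ≤ c

open Tiling

weaken : ∀ {h w c c′} → c ≤ c′ → Tiling h w c → Tiling h w c′
weaken c≤c′ (tiling ps cover few) = tiling ps cover (≤-trans few c≤c′)

transpose : ∀ {h w c} → Tiling h w c → Tiling w h c
transpose {h} {w} {c} (tiling ps cover few) = tiling (map transposePiece ps) cover′ few′
  where
  open PermutationReasoning
  cover′ : cellsOf (map transposePiece ps) ↭ block 0 0 w h
  cover′ = begin
    cellsOf (map transposePiece ps) ≡⟨ cellsOf-map cells-transposePiece ps ⟩
    map swap (cellsOf ps)           ↭⟨ map⁺ swap cover ⟩
    map swap (block 0 0 h w)        ↭⟨ map-swap-block 0 0 h w ⟩
    block 0 0 w h                   ∎
  few′ : monoCount (map transposePiece ps) ≤ c
  few′ = subst (_≤ c) (sym (monoCount-transposePiece ps)) few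

stack : ∀ {h₁ h₂ w c₁ c₂} → Tiling h₁ w c₁ → Tiling h₂ w c₂ → Tiling (h₁ + h₂) w (c₁ + c₂)
stack {h₁} {h₂} {w} {c₁} {c₂} (tiling ps cover few) (tiling qs cover′ few′) =
  tiling (ps ++ map (translatePiece h₁ 0) qs) coverᵥ fewᵥ
  where
  open PermutationReasoning
  coverᵥ : cellsOf (ps ++ map (translatePiece h₁ 0) qs) ↭ block 0 0 (h₁ + h₂) w
  coverᵥ = begin
    cellsOf (ps ++ map (translatePiece h₁ 0) qs)
      ≡⟨ concatMap-++ cells ps (map (translatePiece h₁ 0) qs) ⟩
    cellsOf ps ++ cellsOf (map (translatePiece h₁ 0) qs)
      ≡⟨ cong (cellsOf ps ++_) (cellsOf-map (cells-translatePiece h₁ 0) qs) ⟩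
    cellsOf ps ++ map (translate h₁ 0) (cellsOf qs)
      ↭⟨ ++⁺ cover (map⁺ (translate h₁ 0) cover′) ⟩
    block 0 0 h₁ w ++ map (translate h₁ 0) (block 0 0 h₂ w)
      ≡⟨ cong (block 0 0 h₁ w ++_) (map-translate-block h₁ 0 0 0 h₂ w) ⟩
    block 0 0 h₁ w ++ block h₁ 0 h₂ w
      ≡⟨ block-+ʰ 0 0 h₁ h₂ w ⟨
    block 0 0 (h₁ + h₂) w ∎
  fewᵥ : monoCount (ps ++ map (translatePiece h₁ 0) qs) ≤ c₁ + c₂
  fewᵥ = subst (_≤ c₁ + c₂)
    (sym (trans (monoCount-++ ps _) (cong (monoCount ps +_) (monoCount-translatePiece h₁ 0 qs))))
    (+-mono-≤ few few′)

beside : ∀ {h w₁ w₂ c₁ c₂} → Tiling h w₁ c₁ → Tiling h w₂ c₂ → Tiling h (w₁ + w₂) (c₁ + c₂)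
beside T U = transpose (stack (transpose T) (transpose U))

↭-bySorting : ∀ {xs ys : List Cell} → sort xs ≡ sort ys → xs ↭ ys
↭-bySorting {xs} {ys} sorted = ↭-trans (↭-sym (sort-↭ xs)) (↭-trans (↭-reflexive sorted) (sort-↭ ys))

tilingOf : ∀ {h w} (ps : List Piece) → sort (cellsOf ps) ≡ sort (block 0 0 h w) → Tiling h w (monoCount ps)
tilingOf ps sorted = tiling ps (↭-bySorting sorted) ≤-refl

-- The brick interlocks with its neighbours: it covers the next W columns except the cells
-- `overhang` already covered from the left, and sticks out by the same cells shifted by W.
record PeriodicStrip (h p W : ℕ) : Set where
  field
    left brick     : List Piece
    overhang       : List Cell
    left-covers    : cellsOf left ↭ block 0 0 h p ++ overhang
    brick-covers   : cellsOf brick ++ overhang ↭ block 0 p h W ++ map (translate 0 W) overhang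
    brick-monoFree : monoCount brick ≡ 0

module _ {h p W} (S : PeriodicStrip h p W) where

  open PeriodicStrip S

  bricks : ℕ → List Piece
  bricks zero    = []
  bricks (suc k) = bricks k ++ map (translatePiece 0 (k * W)) brick

  monoCount-bricks : ∀ k → monoCount (bricks k) ≡ 0
  monoCount-bricks zero    = refl
  monoCount-bricks (suc k) = trans (monoCount-++ (bricks k) _)
    (cong₂ _+_ (monoCount-bricks k) (trans (monoCount-translatePiece 0 (k * W) brick) brick-monoFree))

  bricks-covers : ∀ k → cellsOf (bricks k) ++ overhang ↭ block 0 p h (k * W) ++ map (translate 0 (k * W)) overhang
  bricks-covers zero = ↭-reflexive (sym (cong₂ _++_ (block-zeroʷ 0 p h) (map-translate-zero overhang)))
  bricks-covers (suc k) = begin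
    cellsOf (bricks k ++ map (translatePiece 0 kW) brick) ++ overhang
      ≡⟨ cong (_++ overhang) (trans (concatMap-++ cells (bricks k) _)
                                    (cong (cellsOf (bricks k) ++_) (cellsOf-map (cells-translatePiece 0 kW) brick))) ⟩
    (cellsOf (bricks k) ++ shift kW (cellsOf brick)) ++ overhang
      ↭⟨ swap-last (cellsOf (bricks k)) (shift kW (cellsOf brick)) overhang ⟩
    (cellsOf (bricks k) ++ overhang) ++ shift kW (cellsOf brick)
      ↭⟨ ++⁺ʳ _ (bricks-covers k) ⟩
    (block 0 p h kW ++ shift kW overhang) ++ shift kW (cellsOf brick)
      ≡⟨ trans (++-assoc (block 0 p h kW) _ _) (cong (block 0 p h kW ++_) (sym (map-++ (translate 0 kW) overhang _))) ⟩
    block 0 p h kW ++ shift kW (overhang ++ cellsOf brick)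
      ↭⟨ ++⁺ˡ (block 0 p h kW) (map⁺ (translate 0 kW) (↭-trans (++-comm overhang (cellsOf brick)) brick-covers)) ⟩
    block 0 p h kW ++ shift kW (block 0 p h W ++ shift W overhang)
      ≡⟨ cong (block 0 p h kW ++_) (trans (map-++ (translate 0 kW) (block 0 p h W) _)
            (cong₂ _++_ (map-translate-block 0 kW 0 p h W) (map-translate-translate 0 kW 0 W overhang))) ⟩
    block 0 p h kW ++ (block 0 (p + kW) h W ++ shift (W + kW) overhang)
      ≡⟨ ++-assoc (block 0 p h kW) _ _ ⟨
    (block 0 p h kW ++ block 0 (p + kW) h W) ++ shift (W + kW) overhang
      ↭⟨ ++⁺ʳ _ (block-+ʷ 0 p h kW W) ⟨
    block 0 p h (kW + W) ++ shift (W + kW) overhang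
      ≡⟨ cong (λ w → block 0 p h w ++ shift (W + kW) overhang) (+-comm kW W) ⟩
    block 0 p h (W + kW) ++ shift (W + kW) overhang ∎
    where
    open PermutationReasoning
    kW = k * W
    shift : ℕ → List Cell → List Cell
    shift d = map (translate 0 d)
    swap-last : ∀ (xs ys zs : List Cell) → (xs ++ ys) ++ zs ↭ (xs ++ zs) ++ ys
    swap-last xs ys zs = ↭-trans (↭-reflexive (++-assoc xs ys zs))
      (↭-trans (++⁺ˡ xs (++-comm ys zs)) (↭-reflexive (sym (++-assoc xs zs ys))))

  periodicTilings : ∀ q (right : List Piece) → overhang ++ cellsOf right ↭ block 0 p h q →
    ∀ k → Tiling h ((p + q) + k * W) (monoCount left + monoCount right)
  periodicTilings q right right-covers k = tiling pieces′ cover′ few′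
    where
    open PermutationReasoning
    kW = k * W
    shift : List Cell → List Cell
    shift = map (translate 0 kW)
    middle = cellsOf (bricks k)
    pieces′ = left ++ (bricks k ++ map (translatePiece 0 kW) right)
    width≡ : p + (kW + q) ≡ (p + q) + kW
    width≡ = trans (cong (p +_) (+-comm kW q)) (sym (+-assoc p q kW))
    cover′ : cellsOf pieces′ ↭ block 0 0 h ((p + q) + kW)
    cover′ = begin
      cellsOf pieces′
        ≡⟨ trans (concatMap-++ cells left _) (cong (cellsOf left ++_) (trans (concatMap-++ cells (bricks k) _)
             (cong (middle ++_) (cellsOf-map (cells-translatePiece 0 kW) right)))) ⟩
      cellsOf left ++ (middle ++ shift (cellsOf right))
        ↭⟨ ++⁺ʳ _ left-covers ⟩
      (block 0 0 h p ++ overhang) ++ (middle ++ shift (cellsOf right))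
        ≡⟨ ++-assoc (block 0 0 h p) overhang _ ⟩
      block 0 0 h p ++ (overhang ++ middle ++ shift (cellsOf right))
        ↭⟨ ++⁺ˡ (block 0 0 h p) (↭-trans (shifts overhang middle) (↭-reflexive (sym (++-assoc middle overhang _)))) ⟩
      block 0 0 h p ++ ((middle ++ overhang) ++ shift (cellsOf right))
        ↭⟨ ++⁺ˡ (block 0 0 h p) (++⁺ʳ _ (bricks-covers k)) ⟩
      block 0 0 h p ++ ((block 0 p h kW ++ shift overhang) ++ shift (cellsOf right))
        ≡⟨ cong (block 0 0 h p ++_) (trans (++-assoc (block 0 p h kW) _ _)
             (cong (block 0 p h kW ++_) (sym (map-++ (translate 0 kW) overhang _)))) ⟩
      block 0 0 h p ++ (block 0 p h kW ++ shift (overhang ++ cellsOf right))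
        ↭⟨ ++⁺ˡ (block 0 0 h p) (++⁺ˡ (block 0 p h kW) (map⁺ (translate 0 kW) right-covers)) ⟩
      block 0 0 h p ++ (block 0 p h kW ++ shift (block 0 p h q))
        ≡⟨ cong (λ cs → block 0 0 h p ++ (block 0 p h kW ++ cs)) (map-translate-block 0 kW 0 p h q) ⟩
      block 0 0 h p ++ (block 0 p h kW ++ block 0 (p + kW) h q)
        ↭⟨ ++⁺ˡ (block 0 0 h p) (block-+ʷ 0 p h kW q) ⟨
      block 0 0 h p ++ block 0 p h (kW + q)
        ↭⟨ block-+ʷ 0 0 h p (kW + q) ⟨
      block 0 0 h (p + (kW + q))
        ≡⟨ cong (block 0 0 h) width≡ ⟩
      block 0 0 h ((p + q) + kW) ∎
    few′ : monoCount pieces′ ≤ monoCount left + monoCount right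
    few′ = ≤-reflexive (trans (monoCount-++ left _) (cong (monoCount left +_)
      (trans (monoCount-++ (bricks k) _) (cong₂ _+_ (monoCount-bricks k) (monoCount-translatePiece 0 kW right)))))

fourByFour : Tiling 4 4 0
fourByFour = tilingOf (tee stemDown 0 0 ∷ tee stemRight 1 0 ∷ tee stemLeft 0 2 ∷ tee stemUp 2 1 ∷ []) refl


quadRow : ∀ b → Tiling 4 (b * 4) 0
quadRow zero    = tilingOf [] refl
quadRow (suc b) = beside fourByFour (quadRow b)

quadBlocks : ∀ a b → Tiling (a * 4) (b * 4) 0
quadBlocks zero    b = tilingOf [] refl
quadBlocks (suc a) b = stack (quadRow b) (quadBlocks a b)

beside-quadBlocks : ∀ {h c} → (∀ a → Tiling h (a * 4) c) → ∀ a b → Tiling (a * 4) (h + b * 4) c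
beside-quadBlocks {c = c} strips a b =
  subst (Tiling _ _) (+-identityʳ c) (beside (transpose (strips a)) (quadBlocks a b))

data Mod4 : ℕ → Set where
  quad   : ∀ k → Mod4 (k * 4)
  quad+1 : ∀ k → Mod4 (1 + k * 4)
  quad+2 : ∀ k → Mod4 (2 + k * 4)
  quad+3 : ∀ k → Mod4 (3 + k * 4)

mod4 : ∀ n → Mod4 n
mod4 0 = quad 0
mod4 1 = quad+1 0
mod4 2 = quad+2 0
mod4 3 = quad+3 0
mod4 (suc (suc (suc (suc n)))) with mod4 n
... | quad k   = quad (suc k)
... | quad+1 k = quad+1 (suc k)
... | quad+2 k = quad+2 (suc k)
... | quad+3 k = quad+3 (suc k)

widthByQuads : ∀ {h c} n k → Tiling h (n + k * 16) c → Tiling h (n + k * 4 * 4) c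
widthByQuads {h} {c} n k = subst (λ w → Tiling h (n + w) c) (sym (*-assoc k 4 4))

tiling6×4 : Tiling 6 4 4
tiling6×4 = tilingOf
  (tee stemRight 0 0 ∷ tee stemRight 3 0 ∷ tee stemDown 0 1 ∷ mono 2 1 ∷ mono 3 1 ∷ mono 5 1 ∷
   tee stemLeft 1 2 ∷ tee stemRight 3 2 ∷ mono 5 3 ∷ [])
  refl

tiling6×8 : Tiling 6 8 4
tiling6×8 = tilingOf
  (tee stemRight 0 0 ∷ tee stemRight 3 0 ∷ tee stemDown 0 1 ∷ mono 2 1 ∷ mono 3 1 ∷ mono 5 1 ∷
   tee stemDown 2 2 ∷ tee stemRight 3 2 ∷ tee stemUp 0 3 ∷ tee stemUp 4 3 ∷ tee stemUp 2 4 ∷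
   tee stemDown 0 5 ∷ tee stemDown 4 5 ∷ tee stemLeft 1 6 ∷ mono 5 7 ∷ [])
  refl

tiling6×[12+4b] : ∀ b → Tiling 6 (12 + b * 4) 4
tiling6×[12+4b] = periodicTilings strip 11
  (tee stemDown 0 1 ∷ tee stemRight 1 1 ∷ tee stemUp 4 1 ∷ tee stemUp 2 2 ∷ tee stemUp 0 3 ∷
   tee stemDown 4 3 ∷ tee stemDown 2 4 ∷ tee stemDown 0 5 ∷ tee stemUp 4 5 ∷ tee stemUp 2 6 ∷
   tee stemUp 0 7 ∷ tee stemDown 4 7 ∷ tee stemDown 2 8 ∷ tee stemDown 0 9 ∷ tee stemUp 4 9 ∷
   tee stemLeft 2 10 ∷ mono 1 11 ∷ [])
  (↭-bySorting refl)
  where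
  strip : PeriodicStrip 6 1 4
  strip = record
    { left           = mono 0 0 ∷ mono 1 0 ∷ mono 2 0 ∷ tee stemRight 3 0 ∷ []
    ; brick          = tee stemDown 0 1 ∷ tee stemRight 1 1 ∷ tee stemUp 4 1 ∷ tee stemUp 2 2 ∷
                       tee stemLeft 0 3 ∷ tee stemDown 4 3 ∷ []
    ; overhang       = (4 , 1) ∷ []
    ; left-covers    = ↭-bySorting refl
    ; brick-covers   = ↭-bySorting refl
    ; brick-monoFree = refl
    }

tiling6×[13+4b] : ∀ b → Tiling 6 (13 + b * 4) 2
tiling6×[13+4b] = periodicTilings strip 11
  (tee stemUp 0 3 ∷ tee stemDown 2 3 ∷ tee stemDown 4 3 ∷ tee stemDown 0 5 ∷ tee stemUp 2 5 ∷
   tee stemUp 4 5 ∷ tee stemUp 0 7 ∷ tee stemDown 2 7 ∷ tee stemDown 4 7 ∷ tee stemDown 0 9 ∷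
   tee stemUp 2 9 ∷ tee stemUp 4 9 ∷ tee stemLeft 0 11 ∷ mono 2 11 ∷ tee stemLeft 3 11 ∷ [])
  (↭-bySorting refl)
  where
  strip : PeriodicStrip 6 2 4
  strip = record
    { left           = tee stemRight 0 0 ∷ tee stemRight 3 0 ∷ tee stemDown 0 1 ∷ mono 2 1 ∷
                       tee stemUp 2 1 ∷ tee stemUp 4 1 ∷ []
    ; brick          = tee stemUp 0 3 ∷ tee stemDown 2 3 ∷ tee stemDown 4 3 ∷ tee stemDown 0 5 ∷
                       tee stemUp 2 5 ∷ tee stemUp 4 5 ∷ []
    ; overhang       = (0 , 2) ∷ (0 , 3) ∷ (1 , 2) ∷ (3 , 2) ∷ (3 , 3) ∷ (2 , 2) ∷ (5 , 2) ∷
                       (5 , 3) ∷ (4 , 2) ∷ []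
    ; left-covers    = ↭-bySorting refl
    ; brick-covers   = ↭-bySorting refl
    ; brick-monoFree = refl
    }

tiling6×[14+4b] : ∀ b → Tiling 6 (14 + b * 4) 4
tiling6×[14+4b] = periodicTilings strip 12
  (tee stemUp 2 2 ∷ tee stemDown 0 3 ∷ tee stemDown 4 3 ∷ tee stemDown 2 4 ∷ tee stemUp 0 5 ∷
   tee stemUp 4 5 ∷ tee stemUp 2 6 ∷ tee stemDown 0 7 ∷ tee stemDown 4 7 ∷ tee stemDown 2 8 ∷
   tee stemUp 0 9 ∷ tee stemUp 4 9 ∷ tee stemUp 2 10 ∷ tee stemDown 0 11 ∷ tee stemDown 4 11 ∷
   tee stemLeft 1 12 ∷ mono 5 13 ∷ [])
  (↭-bySorting refl)
  where
  strip : PeriodicStrip 6 2 4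
  strip = record
    { left           = mono 0 0 ∷ mono 1 0 ∷ tee stemDown 2 0 ∷ tee stemRight 3 0 ∷ mono 0 1 ∷
                       tee stemUp 0 1 ∷ tee stemUp 4 1 ∷ []
    ; brick          = tee stemUp 2 2 ∷ tee stemDown 0 3 ∷ tee stemDown 4 3 ∷ tee stemDown 2 4 ∷
                       tee stemUp 0 5 ∷ tee stemUp 4 5 ∷ []
    ; overhang       = (2 , 2) ∷ (1 , 2) ∷ (1 , 3) ∷ (0 , 2) ∷ (5 , 2) ∷ (5 , 3) ∷ (4 , 2) ∷ []
    ; left-covers    = ↭-bySorting refl
    ; brick-covers   = ↭-bySorting refl
    ; brick-monoFree = refl
    }

tiling6×[15+4b] : ∀ b → Tiling 6 (15 + b * 4) 2
tiling6×[15+4b] = periodicTilings strip 14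
  (tee stemUp 4 1 ∷ tee stemUp 0 2 ∷ tee stemUp 2 2 ∷ tee stemDown 4 3 ∷ tee stemDown 0 4 ∷
   tee stemDown 2 4 ∷ tee stemUp 4 5 ∷ tee stemUp 0 6 ∷ tee stemUp 2 6 ∷ tee stemDown 4 7 ∷
   tee stemDown 0 8 ∷ tee stemDown 2 8 ∷ tee stemUp 4 9 ∷ tee stemUp 0 10 ∷ tee stemLeft 2 10 ∷
   tee stemDown 0 12 ∷ tee stemRight 2 12 ∷ tee stemUp 4 12 ∷ tee stemLeft 1 13 ∷ mono 4 14 ∷ [])
  (↭-bySorting refl)
  where
  strip : PeriodicStrip 6 1 4
  strip = record
    { left           = tee stemDown 0 0 ∷ mono 1 0 ∷ tee stemDown 2 0 ∷ tee stemRight 3 0 ∷ []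
    ; brick          = tee stemUp 4 1 ∷ tee stemUp 0 2 ∷ tee stemUp 2 2 ∷ tee stemDown 4 3 ∷
                       tee stemDown 0 4 ∷ tee stemDown 2 4 ∷ []
    ; overhang       = (0 , 1) ∷ (0 , 2) ∷ (1 , 1) ∷ (2 , 1) ∷ (2 , 2) ∷ (3 , 1) ∷ (4 , 1) ∷ []
    ; left-covers    = ↭-bySorting refl
    ; brick-covers   = ↭-bySorting refl
    ; brick-monoFree = refl
    }

tiling13×4 : Tiling 13 4 4
tiling13×4 = tilingOf
  (tee stemRight 0 0 ∷ tee stemUp 2 0 ∷ tee stemDown 4 0 ∷ tee stemRight 5 0 ∷ tee stemDown 8 0 ∷
   tee stemRight 9 0 ∷ tee stemUp 11 0 ∷ tee stemDown 0 1 ∷ tee stemUp 6 1 ∷ tee stemLeft 1 2 ∷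
   tee stemLeft 4 2 ∷ tee stemRight 9 2 ∷ mono 8 3 ∷ mono 9 3 ∷ mono 11 3 ∷ mono 12 3 ∷ [])
  refl

tiling13×8 : Tiling 13 8 4
tiling13×8 = tilingOf
  (tee stemRight 0 0 ∷ tee stemLeft 2 0 ∷ tee stemRight 4 0 ∷ tee stemUp 6 0 ∷ tee stemDown 8 0 ∷
   tee stemRight 9 0 ∷ tee stemUp 11 0 ∷ tee stemDown 0 1 ∷ tee stemRight 2 2 ∷ tee stemUp 4 2 ∷
   tee stemDown 6 2 ∷ tee stemRight 9 2 ∷ tee stemUp 0 3 ∷ tee stemDown 2 3 ∷ mono 8 3 ∷ mono 9 3 ∷
   tee stemDown 11 3 ∷ mono 12 3 ∷ tee stemLeft 3 4 ∷ tee stemUp 6 4 ∷ tee stemRight 8 4 ∷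
   tee stemDown 0 5 ∷ tee stemDown 8 5 ∷ mono 10 5 ∷ tee stemUp 11 5 ∷ tee stemLeft 1 6 ∷
   tee stemRight 3 6 ∷ tee stemLeft 5 6 ∷ tee stemLeft 9 6 ∷ [])
  refl

tiling13×12 : Tiling 13 12 4
tiling13×12 = tilingOf
  (tee stemRight 0 0 ∷ tee stemLeft 2 0 ∷ tee stemRight 4 0 ∷ tee stemUp 6 0 ∷ tee stemDown 8 0 ∷
   tee stemRight 9 0 ∷ tee stemUp 11 0 ∷ tee stemDown 0 1 ∷ tee stemRight 2 2 ∷ tee stemUp 4 2 ∷
   tee stemDown 6 2 ∷ tee stemRight 9 2 ∷ tee stemUp 0 3 ∷ tee stemDown 2 3 ∷ mono 8 3 ∷
   tee stemUp 8 3 ∷ mono 11 3 ∷ tee stemUp 11 3 ∷ tee stemDown 4 4 ∷ tee stemUp 6 4 ∷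
   tee stemDown 10 4 ∷ tee stemDown 0 5 ∷ tee stemUp 2 5 ∷ tee stemDown 8 5 ∷ tee stemUp 4 6 ∷
   tee stemDown 6 6 ∷ mono 11 6 ∷ tee stemUp 11 6 ∷ tee stemUp 0 7 ∷ tee stemDown 2 7 ∷
   tee stemUp 8 7 ∷ tee stemDown 10 7 ∷ tee stemLeft 3 8 ∷ tee stemUp 6 8 ∷ tee stemDown 0 9 ∷
   tee stemDown 8 9 ∷ mono 11 9 ∷ tee stemUp 11 9 ∷ tee stemLeft 1 10 ∷ tee stemRight 3 10 ∷
   tee stemLeft 5 10 ∷ tee stemLeft 9 10 ∷ [])
  refl

tiling13×16 : Tiling 13 16 4
tiling13×16 = tilingOf
  (tee stemRight 0 0 ∷ tee stemLeft 2 0 ∷ tee stemRight 4 0 ∷ tee stemUp 6 0 ∷ tee stemDown 8 0 ∷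
   tee stemRight 9 0 ∷ tee stemUp 11 0 ∷ tee stemDown 0 1 ∷ tee stemRight 2 2 ∷ tee stemUp 4 2 ∷
   tee stemDown 6 2 ∷ tee stemRight 9 2 ∷ tee stemUp 0 3 ∷ tee stemDown 2 3 ∷ mono 8 3 ∷
   tee stemLeft 8 3 ∷ mono 11 3 ∷ tee stemUp 11 3 ∷ tee stemDown 4 4 ∷ tee stemUp 6 4 ∷
   tee stemDown 0 5 ∷ tee stemUp 2 5 ∷ tee stemRight 8 5 ∷ tee stemLeft 10 5 ∷ tee stemUp 4 6 ∷
   tee stemDown 6 6 ∷ tee stemDown 8 6 ∷ tee stemUp 0 7 ∷ tee stemDown 2 7 ∷ tee stemUp 9 7 ∷
   tee stemDown 11 7 ∷ mono 12 7 ∷ tee stemDown 4 8 ∷ tee stemLeft 6 8 ∷ tee stemDown 0 9 ∷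
   tee stemUp 2 9 ∷ tee stemDown 9 9 ∷ tee stemUp 11 9 ∷ tee stemUp 4 10 ∷ tee stemRight 6 10 ∷
   tee stemUp 0 11 ∷ tee stemDown 2 11 ∷ tee stemDown 6 11 ∷ mono 8 11 ∷ tee stemUp 9 11 ∷
   tee stemDown 11 11 ∷ tee stemLeft 3 12 ∷ tee stemLeft 7 12 ∷ tee stemDown 0 13 ∷
   tee stemUp 11 13 ∷ tee stemLeft 1 14 ∷ tee stemRight 3 14 ∷ tee stemLeft 5 14 ∷
   tee stemRight 7 14 ∷ tee stemLeft 9 14 ∷ [])
  refl

tiling13×13 : Tiling 13 13 5
tiling13×13 = tilingOf
  (tee stemRight 0 0 ∷ tee stemUp 2 0 ∷ tee stemDown 4 0 ∷ tee stemRight 5 0 ∷ tee stemLeft 7 0 ∷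
   tee stemRight 9 0 ∷ tee stemUp 11 0 ∷ tee stemDown 0 1 ∷ tee stemDown 2 2 ∷ tee stemUp 4 2 ∷
   tee stemDown 6 2 ∷ tee stemRight 7 2 ∷ tee stemUp 9 2 ∷ tee stemDown 11 2 ∷ tee stemUp 0 3 ∷
   tee stemUp 2 4 ∷ tee stemDown 4 4 ∷ mono 7 4 ∷ tee stemUp 7 4 ∷ tee stemDown 9 4 ∷
   tee stemUp 11 4 ∷ tee stemDown 0 5 ∷ tee stemLeft 5 5 ∷ tee stemLeft 1 6 ∷ tee stemUp 9 6 ∷
   tee stemDown 11 6 ∷ tee stemDown 4 7 ∷ tee stemRight 5 7 ∷ tee stemLeft 7 7 ∷ tee stemDown 0 8 ∷
   tee stemRight 1 8 ∷ tee stemUp 11 8 ∷ tee stemUp 2 9 ∷ tee stemLeft 4 9 ∷ tee stemRight 6 9 ∷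
   tee stemUp 8 9 ∷ tee stemDown 10 9 ∷ tee stemLeft 0 10 ∷ tee stemLeft 3 11 ∷ tee stemRight 5 11 ∷
   tee stemLeft 7 11 ∷ tee stemLeft 10 11 ∷ mono 12 11 ∷ mono 0 12 ∷ mono 1 12 ∷ mono 2 12 ∷ [])
  refl

tiling13×17 : Tiling 13 17 5
tiling13×17 = tilingOf
  (tee stemDown 0 0 ∷ tee stemRight 1 0 ∷ tee stemLeft 3 0 ∷ tee stemRight 5 0 ∷ tee stemUp 7 0 ∷
   tee stemDown 9 0 ∷ tee stemRight 10 0 ∷ tee stemUp 11 1 ∷ tee stemUp 0 2 ∷ tee stemDown 2 2 ∷
   tee stemRight 3 2 ∷ tee stemUp 5 2 ∷ tee stemDown 7 2 ∷ tee stemLeft 9 2 ∷ tee stemDown 0 4 ∷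
   tee stemUp 2 4 ∷ mono 4 4 ∷ tee stemLeft 4 4 ∷ tee stemUp 7 4 ∷ tee stemDown 9 4 ∷
   tee stemRight 10 4 ∷ tee stemUp 11 5 ∷ tee stemUp 0 6 ∷ tee stemDown 2 6 ∷ tee stemRight 4 6 ∷
   tee stemLeft 6 6 ∷ tee stemLeft 9 6 ∷ tee stemLeft 3 7 ∷ tee stemDown 0 8 ∷ tee stemRight 6 8 ∷
   tee stemLeft 8 8 ∷ tee stemRight 10 8 ∷ tee stemLeft 1 9 ∷ tee stemRight 3 9 ∷ tee stemLeft 5 9 ∷
   tee stemUp 11 9 ∷ tee stemRight 8 10 ∷ tee stemDown 0 11 ∷ tee stemRight 1 11 ∷
   tee stemLeft 3 11 ∷ tee stemRight 5 11 ∷ tee stemUp 7 11 ∷ tee stemUp 9 11 ∷ tee stemDown 11 11 ∷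
   tee stemRight 1 13 ∷ tee stemLeft 3 13 ∷ tee stemRight 5 13 ∷ mono 9 13 ∷ tee stemUp 11 13 ∷
   tee stemDown 0 14 ∷ mono 1 14 ∷ mono 7 14 ∷ tee stemUp 7 14 ∷ tee stemDown 9 14 ∷ mono 10 14 ∷
   tee stemLeft 1 15 ∷ tee stemRight 3 15 ∷ tee stemLeft 5 15 ∷ tee stemLeft 10 15 ∷ [])
  refl

tiling13×15 : Tiling 13 15 3
tiling13×15 = tilingOf
  (mono 0 0 ∷ tee stemRight 1 0 ∷ tee stemLeft 3 0 ∷ tee stemRight 5 0 ∷ tee stemLeft 7 0 ∷
   tee stemRight 9 0 ∷ tee stemUp 11 0 ∷ mono 0 1 ∷ tee stemLeft 0 1 ∷ tee stemRight 3 2 ∷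
   tee stemLeft 5 2 ∷ tee stemRight 7 2 ∷ tee stemUp 9 2 ∷ tee stemDown 11 2 ∷ tee stemRight 0 3 ∷
   tee stemLeft 2 3 ∷ tee stemDown 0 4 ∷ tee stemRight 5 4 ∷ tee stemUp 7 4 ∷ tee stemDown 9 4 ∷
   tee stemUp 11 4 ∷ tee stemRight 2 5 ∷ tee stemLeft 4 5 ∷ tee stemUp 0 6 ∷ tee stemDown 2 6 ∷
   tee stemDown 7 6 ∷ tee stemUp 9 6 ∷ tee stemDown 11 6 ∷ tee stemRight 4 7 ∷ tee stemDown 0 8 ∷
   tee stemUp 2 8 ∷ tee stemDown 4 8 ∷ mono 6 8 ∷ tee stemUp 7 8 ∷ tee stemDown 9 8 ∷
   tee stemUp 11 8 ∷ tee stemLeft 5 9 ∷ tee stemUp 0 10 ∷ tee stemDown 2 10 ∷ tee stemUp 9 10 ∷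
   tee stemDown 11 10 ∷ tee stemLeft 3 11 ∷ tee stemRight 5 11 ∷ tee stemLeft 7 11 ∷
   tee stemDown 0 12 ∷ tee stemUp 11 12 ∷ tee stemLeft 1 13 ∷ tee stemRight 3 13 ∷
   tee stemLeft 5 13 ∷ tee stemRight 7 13 ∷ tee stemLeft 9 13 ∷ [])
  refl

tiling13×19 : Tiling 13 19 3
tiling13×19 = tilingOf
  (mono 0 0 ∷ tee stemLeft 0 0 ∷ tee stemRight 2 0 ∷ tee stemDown 5 0 ∷ tee stemRight 6 0 ∷
   tee stemDown 9 0 ∷ tee stemRight 10 0 ∷ tee stemUp 3 1 ∷ tee stemUp 7 1 ∷ tee stemUp 11 1 ∷
   tee stemRight 0 2 ∷ tee stemUp 5 2 ∷ tee stemUp 9 2 ∷ mono 0 3 ∷ tee stemUp 1 3 ∷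
   tee stemDown 3 3 ∷ tee stemDown 7 3 ∷ tee stemDown 11 3 ∷ tee stemDown 0 4 ∷ tee stemDown 5 4 ∷
   tee stemDown 9 4 ∷ tee stemUp 3 5 ∷ tee stemUp 7 5 ∷ tee stemUp 11 5 ∷ tee stemUp 0 6 ∷
   tee stemDown 2 6 ∷ tee stemLeft 5 6 ∷ tee stemLeft 9 6 ∷ tee stemDown 0 8 ∷ tee stemUp 2 8 ∷
   tee stemDown 4 8 ∷ tee stemRight 5 8 ∷ tee stemLeft 7 8 ∷ tee stemRight 9 8 ∷ tee stemUp 11 8 ∷
   tee stemUp 0 10 ∷ tee stemDown 2 10 ∷ tee stemUp 4 10 ∷ tee stemDown 6 10 ∷ tee stemRight 7 10 ∷
   tee stemUp 9 10 ∷ tee stemDown 11 10 ∷ tee stemDown 0 12 ∷ tee stemUp 2 12 ∷ tee stemDown 4 12 ∷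
   mono 7 12 ∷ tee stemUp 7 12 ∷ tee stemDown 9 12 ∷ tee stemUp 11 12 ∷ tee stemLeft 5 13 ∷
   tee stemUp 0 14 ∷ tee stemDown 2 14 ∷ tee stemUp 9 14 ∷ tee stemDown 11 14 ∷ tee stemLeft 3 15 ∷
   tee stemRight 5 15 ∷ tee stemLeft 7 15 ∷ tee stemDown 0 16 ∷ tee stemUp 11 16 ∷
   tee stemLeft 1 17 ∷ tee stemRight 3 17 ∷ tee stemLeft 5 17 ∷ tee stemRight 7 17 ∷
   tee stemLeft 9 17 ∷ [])
  refl

tiling13×23 : Tiling 13 23 3
tiling13×23 = tilingOf
  (tee stemDown 0 0 ∷ mono 1 0 ∷ tee stemRight 2 0 ∷ tee stemUp 4 0 ∷ tee stemRight 6 0 ∷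
   tee stemLeft 8 0 ∷ tee stemRight 10 0 ∷ tee stemLeft 1 1 ∷ tee stemDown 6 1 ∷ tee stemUp 11 1 ∷
   tee stemDown 4 2 ∷ tee stemRight 8 2 ∷ tee stemDown 0 3 ∷ tee stemRight 1 3 ∷ tee stemUp 6 3 ∷
   tee stemDown 8 3 ∷ mono 10 3 ∷ tee stemDown 11 3 ∷ tee stemLeft 2 4 ∷ tee stemDown 5 4 ∷
   tee stemUp 9 4 ∷ tee stemUp 0 5 ∷ tee stemUp 11 5 ∷ tee stemRight 2 6 ∷ tee stemRight 6 6 ∷
   tee stemLeft 8 6 ∷ tee stemDown 0 7 ∷ tee stemDown 2 7 ∷ tee stemRight 4 7 ∷ tee stemLeft 10 7 ∷
   tee stemLeft 3 8 ∷ tee stemRight 6 8 ∷ tee stemUp 8 8 ∷ tee stemLeft 0 9 ∷ tee stemDown 6 9 ∷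
   tee stemRight 10 9 ∷ tee stemRight 3 10 ∷ tee stemUp 7 10 ∷ tee stemUp 9 10 ∷ tee stemUp 11 10 ∷
   tee stemRight 0 11 ∷ tee stemLeft 2 11 ∷ tee stemDown 5 11 ∷ tee stemDown 0 12 ∷
   tee stemUp 6 12 ∷ tee stemUp 8 12 ∷ tee stemLeft 10 12 ∷ tee stemRight 2 13 ∷ tee stemUp 0 14 ∷
   tee stemDown 2 14 ∷ tee stemRight 4 14 ∷ tee stemLeft 7 14 ∷ tee stemRight 10 14 ∷
   tee stemDown 4 15 ∷ tee stemDown 6 15 ∷ tee stemUp 9 15 ∷ tee stemUp 11 15 ∷ tee stemDown 0 16 ∷
   tee stemUp 2 16 ∷ tee stemLeft 7 16 ∷ tee stemUp 4 17 ∷ tee stemDown 11 17 ∷ tee stemUp 0 18 ∷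
   tee stemDown 2 18 ∷ tee stemDown 6 18 ∷ tee stemRight 7 18 ∷ tee stemUp 9 18 ∷
   tee stemLeft 3 19 ∷ tee stemUp 11 19 ∷ tee stemDown 0 20 ∷ mono 7 20 ∷ tee stemUp 7 20 ∷
   tee stemDown 9 20 ∷ tee stemLeft 1 21 ∷ tee stemRight 3 21 ∷ tee stemLeft 5 21 ∷
   tee stemLeft 10 21 ∷ [])
  refl

strip13 : PeriodicStrip 13 8 16
strip13 = record
  { left           = tee stemDown 0 0 ∷ tee stemRight 1 0 ∷ tee stemDown 4 0 ∷ mono 5 0 ∷
                     tee stemRight 6 0 ∷ tee stemLeft 8 0 ∷ tee stemRight 10 0 ∷ tee stemUp 2 1 ∷
                     tee stemLeft 5 1 ∷ tee stemUp 11 1 ∷ tee stemUp 0 2 ∷ tee stemRight 8 2 ∷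
                     tee stemDown 2 3 ∷ tee stemDown 4 3 ∷ tee stemRight 5 3 ∷ tee stemUp 7 3 ∷
                     tee stemUp 9 3 ∷ tee stemDown 11 3 ∷ tee stemDown 0 4 ∷ tee stemLeft 2 5 ∷
                     tee stemRight 5 5 ∷ tee stemLeft 8 5 ∷ tee stemUp 11 5 ∷ tee stemLeft 0 6 ∷
                     tee stemUp 4 6 ∷ tee stemUp 6 6 ∷ tee stemDown 3 7 ∷ tee stemRight 8 7 ∷
                     tee stemLeft 10 7 ∷ []
  ; brick          = tee stemRight 0 8 ∷ tee stemUp 5 8 ∷ tee stemUp 7 8 ∷ tee stemDown 0 9 ∷
                     tee stemDown 2 9 ∷ tee stemDown 4 9 ∷ tee stemRight 9 9 ∷ tee stemUp 11 9 ∷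
                     tee stemUp 6 10 ∷ tee stemLeft 8 10 ∷ tee stemUp 0 11 ∷ tee stemUp 2 11 ∷
                     tee stemUp 4 11 ∷ tee stemDown 11 11 ∷ tee stemDown 6 12 ∷ tee stemRight 8 12 ∷
                     tee stemDown 0 13 ∷ tee stemDown 2 13 ∷ tee stemDown 4 13 ∷ tee stemUp 7 13 ∷
                     tee stemUp 9 13 ∷ tee stemUp 11 13 ∷ tee stemUp 0 15 ∷ tee stemLeft 2 15 ∷
                     tee stemRight 5 15 ∷ tee stemUp 8 15 ∷ tee stemLeft 10 15 ∷ tee stemDown 5 16 ∷
                     tee stemDown 7 16 ∷ tee stemDown 0 17 ∷ tee stemRight 2 17 ∷
                     tee stemRight 10 17 ∷ tee stemLeft 1 18 ∷ tee stemDown 4 18 ∷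
                     tee stemDown 6 18 ∷ tee stemRight 8 18 ∷ tee stemUp 11 18 ∷ tee stemUp 7 19 ∷
                     tee stemUp 9 19 ∷ tee stemDown 0 20 ∷ tee stemRight 1 20 ∷ tee stemLeft 4 20 ∷
                     tee stemDown 11 20 ∷ tee stemLeft 2 21 ∷ tee stemLeft 6 21 ∷
                     tee stemDown 9 21 ∷ tee stemLeft 0 22 ∷ tee stemUp 4 22 ∷ tee stemUp 11 22 ∷
                     tee stemDown 3 23 ∷ tee stemRight 6 23 ∷ tee stemLeft 9 23 ∷ []
  ; overhang       = (5 , 8) ∷ (7 , 8) ∷ (3 , 8) ∷ (3 , 9) ∷ (4 , 8) ∷ (9 , 8) ∷ (10 , 8) ∷
                     (11 , 8) ∷ (12 , 8) ∷ []
  ; left-covers    = ↭-bySorting refl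
  ; brick-covers   = ↭-bySorting refl
  ; brick-monoFree = refl
  }

tiling13×[20+16k] : ∀ k → Tiling 13 (20 + k * 16) 4
tiling13×[20+16k] = periodicTilings strip13 12
  (tee stemDown 0 17 ∷ tee stemLeft 1 18 ∷ mono 4 19 ∷ tee stemRight 4 18 ∷ tee stemLeft 6 18 ∷
   tee stemDown 9 17 ∷ tee stemLeft 10 18 ∷ tee stemUp 2 16 ∷ tee stemUp 7 16 ∷ tee stemUp 11 16 ∷
   tee stemUp 0 15 ∷ tee stemLeft 4 16 ∷ tee stemRight 9 16 ∷ tee stemDown 2 14 ∷
   tee stemDown 4 14 ∷ mono 6 16 ∷ tee stemRight 6 15 ∷ tee stemDown 0 13 ∷ tee stemLeft 9 14 ∷
   tee stemUp 11 13 ∷ tee stemRight 2 13 ∷ tee stemDown 5 12 ∷ tee stemLeft 6 13 ∷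
   tee stemRight 8 13 ∷ tee stemUp 0 11 ∷ tee stemDown 11 11 ∷ tee stemLeft 2 11 ∷ tee stemUp 5 10 ∷
   tee stemDown 7 10 ∷ tee stemLeft 8 11 ∷ tee stemDown 0 9 ∷ tee stemDown 2 9 ∷ tee stemDown 4 9 ∷
   tee stemUp 9 9 ∷ tee stemUp 11 9 ∷ tee stemDown 8 8 ∷ tee stemRight 0 8 ∷ tee stemLeft 5 8 ∷
   mono 11 9 ∷ [])
  (↭-bySorting refl)

tiling13×[24+16k] : ∀ k → Tiling 13 (24 + k * 16) 4
tiling13×[24+16k] = periodicTilings strip13 16
  (tee stemDown 0 21 ∷ mono 1 23 ∷ tee stemLeft 2 22 ∷ tee stemRight 4 22 ∷ tee stemLeft 6 22 ∷
   tee stemDown 9 21 ∷ tee stemLeft 10 22 ∷ tee stemRight 1 21 ∷ tee stemUp 7 20 ∷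
   tee stemUp 11 20 ∷ tee stemLeft 4 20 ∷ tee stemUp 9 19 ∷ tee stemDown 0 18 ∷ tee stemLeft 1 19 ∷
   tee stemUp 3 18 ∷ tee stemUp 5 18 ∷ tee stemDown 7 18 ∷ tee stemDown 11 18 ∷ tee stemDown 9 17 ∷
   tee stemUp 0 16 ∷ mono 2 18 ∷ tee stemUp 2 16 ∷ tee stemRight 4 17 ∷ tee stemUp 7 16 ∷
   tee stemUp 11 16 ∷ tee stemRight 9 16 ∷ tee stemDown 0 14 ∷ tee stemDown 2 14 ∷
   tee stemLeft 4 15 ∷ tee stemRight 6 15 ∷ tee stemUp 3 13 ∷ tee stemLeft 9 14 ∷ tee stemUp 11 13 ∷
   tee stemRight 0 13 ∷ tee stemDown 5 12 ∷ tee stemLeft 6 13 ∷ tee stemRight 8 13 ∷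
   tee stemDown 3 11 ∷ tee stemDown 11 11 ∷ tee stemLeft 0 11 ∷ tee stemUp 5 10 ∷
   tee stemDown 7 10 ∷ tee stemLeft 8 11 ∷ tee stemDown 0 9 ∷ tee stemDown 2 9 ∷ tee stemDown 4 9 ∷
   tee stemUp 9 9 ∷ tee stemUp 11 9 ∷ tee stemDown 8 8 ∷ tee stemRight 0 8 ∷ tee stemLeft 5 8 ∷
   mono 11 9 ∷ [])
  (↭-bySorting refl)

tiling13×[28+16k] : ∀ k → Tiling 13 (28 + k * 16) 4
tiling13×[28+16k] = periodicTilings strip13 20
  (tee stemDown 0 25 ∷ tee stemLeft 1 26 ∷ mono 4 27 ∷ tee stemRight 4 26 ∷ tee stemLeft 6 26 ∷
   tee stemDown 9 25 ∷ tee stemLeft 10 26 ∷ tee stemRight 2 25 ∷ tee stemUp 7 24 ∷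
   tee stemUp 11 24 ∷ tee stemRight 0 24 ∷ tee stemUp 4 23 ∷ tee stemDown 6 23 ∷ tee stemUp 9 23 ∷
   tee stemDown 3 22 ∷ tee stemDown 11 22 ∷ tee stemLeft 0 22 ∷ tee stemLeft 7 22 ∷
   tee stemDown 0 20 ∷ tee stemDown 2 20 ∷ tee stemDown 4 20 ∷ tee stemLeft 5 21 ∷ mono 9 22 ∷
   tee stemUp 9 20 ∷ tee stemUp 11 20 ∷ tee stemUp 6 19 ∷ tee stemDown 8 19 ∷ tee stemRight 0 19 ∷
   tee stemDown 3 18 ∷ tee stemDown 5 18 ∷ tee stemRight 10 19 ∷ tee stemUp 8 17 ∷
   tee stemLeft 0 17 ∷ tee stemUp 3 16 ∷ tee stemUp 5 16 ∷ tee stemDown 7 16 ∷ tee stemLeft 10 17 ∷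
   tee stemDown 0 15 ∷ tee stemDown 2 15 ∷ tee stemUp 9 15 ∷ tee stemUp 11 15 ∷ tee stemRight 4 15 ∷
   tee stemDown 8 14 ∷ tee stemRight 0 14 ∷ tee stemDown 3 13 ∷ tee stemUp 6 13 ∷
   tee stemRight 10 14 ∷ tee stemRight 4 13 ∷ tee stemUp 8 12 ∷ tee stemLeft 0 12 ∷
   tee stemLeft 10 12 ∷ tee stemDown 0 10 ∷ tee stemLeft 2 11 ∷ tee stemDown 5 10 ∷
   tee stemLeft 6 11 ∷ tee stemUp 9 10 ∷ tee stemUp 11 10 ∷ tee stemUp 1 9 ∷ tee stemUp 3 9 ∷
   tee stemRight 7 10 ∷ tee stemUp 5 8 ∷ tee stemRight 10 9 ∷ mono 0 9 ∷ tee stemRight 0 8 ∷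
   tee stemLeft 7 8 ∷ [])
  (↭-bySorting refl)

tiling13×[32+16k] : ∀ k → Tiling 13 (32 + k * 16) 4
tiling13×[32+16k] = periodicTilings strip13 24
  (tee stemDown 0 29 ∷ mono 1 31 ∷ tee stemLeft 2 30 ∷ tee stemUp 4 29 ∷ tee stemLeft 6 30 ∷
   tee stemRight 8 30 ∷ tee stemLeft 10 30 ∷ tee stemRight 1 29 ∷ tee stemDown 6 28 ∷
   tee stemUp 11 28 ∷ tee stemDown 4 27 ∷ tee stemLeft 8 28 ∷ tee stemDown 0 26 ∷
   tee stemLeft 1 27 ∷ tee stemUp 6 26 ∷ tee stemDown 8 26 ∷ mono 10 28 ∷ tee stemDown 11 26 ∷
   tee stemRight 2 26 ∷ tee stemDown 5 25 ∷ tee stemUp 9 25 ∷ tee stemUp 0 24 ∷ tee stemUp 11 24 ∷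
   tee stemLeft 2 24 ∷ tee stemLeft 6 24 ∷ tee stemRight 8 24 ∷ tee stemDown 0 22 ∷
   tee stemDown 2 22 ∷ tee stemLeft 4 23 ∷ tee stemRight 10 23 ∷ tee stemRight 3 22 ∷
   tee stemLeft 6 22 ∷ tee stemUp 8 21 ∷ tee stemUp 0 20 ∷ tee stemDown 6 20 ∷ tee stemLeft 10 21 ∷
   tee stemDown 2 19 ∷ tee stemLeft 3 20 ∷ tee stemUp 7 19 ∷ tee stemUp 9 19 ∷ tee stemUp 11 19 ∷
   tee stemDown 0 18 ∷ tee stemRight 4 19 ∷ tee stemRight 2 18 ∷ tee stemUp 6 17 ∷ tee stemUp 8 17 ∷
   tee stemRight 10 18 ∷ tee stemUp 0 16 ∷ tee stemDown 5 16 ∷ tee stemLeft 2 16 ∷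
   tee stemRight 7 16 ∷ tee stemLeft 10 16 ∷ tee stemDown 0 14 ∷ tee stemDown 2 14 ∷
   tee stemDown 4 14 ∷ tee stemDown 6 14 ∷ tee stemUp 9 14 ∷ tee stemUp 11 14 ∷ tee stemUp 7 13 ∷
   tee stemRight 0 13 ∷ tee stemDown 3 12 ∷ tee stemDown 5 12 ∷ tee stemDown 9 12 ∷
   tee stemDown 11 12 ∷ tee stemDown 7 11 ∷ tee stemLeft 0 11 ∷ tee stemUp 3 10 ∷ tee stemUp 5 10 ∷
   tee stemUp 9 10 ∷ tee stemUp 11 10 ∷ tee stemDown 0 9 ∷ tee stemDown 2 9 ∷ tee stemRight 7 10 ∷
   tee stemRight 4 9 ∷ tee stemRight 10 9 ∷ tee stemRight 0 8 ∷ tee stemLeft 7 8 ∷ mono 6 8 ∷ [])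
  (↭-bySorting refl)

tiling13×[21+16k] : ∀ k → Tiling 13 (21 + k * 16) 5
tiling13×[21+16k] = periodicTilings strip13 13
  (tee stemDown 0 18 ∷ mono 1 20 ∷ tee stemDown 2 18 ∷ tee stemLeft 3 19 ∷ tee stemDown 6 18 ∷
   tee stemLeft 7 19 ∷ tee stemLeft 10 19 ∷ tee stemUp 4 17 ∷ tee stemRight 8 18 ∷ mono 10 19 ∷
   tee stemUp 11 17 ∷ tee stemUp 0 16 ∷ tee stemUp 2 16 ∷ tee stemUp 6 16 ∷ tee stemDown 4 15 ∷
   tee stemLeft 8 16 ∷ tee stemDown 11 15 ∷ tee stemDown 0 14 ∷ tee stemDown 2 14 ∷
   tee stemUp 5 14 ∷ tee stemUp 7 14 ∷ tee stemUp 9 14 ∷ tee stemUp 11 13 ∷ tee stemRight 0 13 ∷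
   tee stemLeft 3 13 ∷ tee stemUp 6 12 ∷ tee stemRight 8 13 ∷ tee stemDown 3 11 ∷
   tee stemDown 5 11 ∷ tee stemDown 11 11 ∷ tee stemLeft 0 11 ∷ tee stemLeft 8 11 ∷
   tee stemDown 0 9 ∷ tee stemDown 2 9 ∷ tee stemDown 4 9 ∷ tee stemLeft 6 10 ∷ tee stemUp 9 9 ∷
   tee stemUp 11 9 ∷ tee stemDown 6 8 ∷ tee stemDown 8 8 ∷ tee stemRight 0 8 ∷ mono 5 9 ∷
   mono 11 9 ∷ [])
  (↭-bySorting refl)

tiling13×[25+16k] : ∀ k → Tiling 13 (25 + k * 16) 5
tiling13×[25+16k] = periodicTilings strip13 17
  (tee stemDown 0 22 ∷ mono 1 24 ∷ tee stemDown 2 22 ∷ tee stemLeft 3 23 ∷ tee stemLeft 6 23 ∷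
   mono 9 24 ∷ tee stemLeft 10 23 ∷ tee stemUp 4 21 ∷ tee stemDown 6 21 ∷ tee stemLeft 8 22 ∷
   tee stemUp 11 21 ∷ tee stemRight 0 21 ∷ tee stemDown 3 20 ∷ tee stemUp 7 20 ∷
   tee stemRight 9 21 ∷ tee stemLeft 0 19 ∷ tee stemLeft 4 19 ∷ tee stemRight 6 19 ∷
   tee stemLeft 9 19 ∷ tee stemUp 11 18 ∷ tee stemDown 0 17 ∷ tee stemLeft 2 18 ∷
   tee stemRight 8 18 ∷ tee stemRight 1 17 ∷ tee stemLeft 4 17 ∷ tee stemUp 6 16 ∷
   tee stemDown 11 16 ∷ tee stemDown 4 15 ∷ tee stemLeft 8 16 ∷ tee stemDown 0 14 ∷
   tee stemLeft 1 15 ∷ tee stemUp 5 14 ∷ tee stemUp 7 14 ∷ tee stemUp 9 14 ∷ tee stemUp 11 14 ∷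
   tee stemRight 2 14 ∷ tee stemRight 0 13 ∷ tee stemUp 4 12 ∷ tee stemUp 6 12 ∷
   tee stemRight 8 13 ∷ tee stemDown 11 12 ∷ tee stemDown 3 11 ∷ tee stemLeft 0 11 ∷
   tee stemRight 5 11 ∷ tee stemLeft 8 11 ∷ tee stemUp 11 10 ∷ tee stemDown 0 9 ∷ tee stemDown 2 9 ∷
   tee stemDown 4 9 ∷ tee stemRight 7 10 ∷ tee stemDown 10 9 ∷ tee stemUp 5 8 ∷ tee stemRight 0 8 ∷
   tee stemLeft 7 8 ∷ mono 11 9 ∷ mono 12 9 ∷ [])
  (↭-bySorting refl)

tiling13×[29+16k] : ∀ k → Tiling 13 (29 + k * 16) 5
tiling13×[29+16k] = periodicTilings strip13 21
  (tee stemDown 0 26 ∷ mono 1 28 ∷ tee stemDown 2 26 ∷ tee stemLeft 3 27 ∷ tee stemLeft 6 27 ∷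
   tee stemLeft 9 27 ∷ tee stemUp 11 26 ∷ tee stemUp 4 25 ∷ tee stemDown 6 25 ∷ tee stemDown 8 25 ∷
   mono 9 27 ∷ tee stemRight 0 25 ∷ tee stemDown 3 24 ∷ tee stemUp 9 24 ∷ tee stemDown 11 24 ∷
   tee stemDown 7 23 ∷ tee stemLeft 0 23 ∷ tee stemLeft 4 23 ∷ tee stemDown 9 22 ∷
   tee stemUp 11 22 ∷ tee stemDown 0 21 ∷ tee stemLeft 2 22 ∷ tee stemUp 5 21 ∷ tee stemUp 7 21 ∷
   tee stemRight 1 21 ∷ tee stemDown 4 20 ∷ tee stemUp 9 20 ∷ tee stemDown 11 20 ∷
   tee stemRight 6 20 ∷ tee stemDown 0 18 ∷ tee stemLeft 1 19 ∷ tee stemRight 4 19 ∷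
   tee stemRight 8 19 ∷ tee stemUp 11 18 ∷ tee stemRight 2 18 ∷ tee stemUp 6 17 ∷
   tee stemRight 0 17 ∷ tee stemRight 4 17 ∷ tee stemLeft 8 17 ∷ tee stemDown 11 16 ∷
   tee stemDown 3 15 ∷ tee stemUp 7 15 ∷ tee stemUp 9 15 ∷ tee stemLeft 0 15 ∷ tee stemUp 4 14 ∷
   tee stemDown 6 14 ∷ tee stemUp 11 14 ∷ tee stemDown 0 13 ∷ tee stemDown 2 13 ∷
   tee stemRight 8 14 ∷ tee stemRight 3 13 ∷ tee stemRight 6 13 ∷ tee stemRight 10 13 ∷
   tee stemUp 0 11 ∷ tee stemUp 8 11 ∷ tee stemDown 2 10 ∷ tee stemLeft 3 11 ∷ tee stemUp 5 10 ∷
   tee stemDown 7 10 ∷ tee stemLeft 10 11 ∷ tee stemDown 0 9 ∷ tee stemUp 9 9 ∷ tee stemUp 11 9 ∷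
   tee stemLeft 3 9 ∷ tee stemDown 8 8 ∷ tee stemRight 0 8 ∷ mono 2 9 ∷ tee stemLeft 5 8 ∷
   mono 11 9 ∷ [])
  (↭-bySorting refl)

tiling13×[33+16k] : ∀ k → Tiling 13 (33 + k * 16) 5
tiling13×[33+16k] = periodicTilings strip13 25
  (mono 0 32 ∷ tee stemUp 0 30 ∷ tee stemLeft 2 31 ∷ tee stemLeft 5 31 ∷ tee stemRight 7 31 ∷
   tee stemLeft 9 31 ∷ tee stemUp 11 30 ∷ tee stemDown 2 29 ∷ mono 4 31 ∷ tee stemRight 4 30 ∷
   tee stemDown 0 28 ∷ tee stemLeft 7 29 ∷ tee stemUp 9 28 ∷ tee stemDown 11 28 ∷
   tee stemRight 2 28 ∷ tee stemLeft 4 28 ∷ tee stemRight 6 28 ∷ tee stemRight 0 27 ∷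
   tee stemRight 8 27 ∷ tee stemUp 11 26 ∷ tee stemDown 3 25 ∷ tee stemLeft 4 26 ∷ tee stemUp 6 25 ∷
   tee stemLeft 0 25 ∷ tee stemLeft 8 25 ∷ tee stemDown 11 24 ∷ tee stemDown 0 23 ∷
   tee stemDown 2 23 ∷ tee stemLeft 4 24 ∷ tee stemUp 7 23 ∷ tee stemUp 9 23 ∷ tee stemUp 3 22 ∷
   tee stemUp 5 22 ∷ tee stemUp 11 22 ∷ tee stemRight 0 22 ∷ tee stemDown 7 21 ∷ tee stemDown 9 21 ∷
   tee stemDown 3 20 ∷ tee stemDown 5 20 ∷ tee stemDown 11 20 ∷ tee stemLeft 0 20 ∷
   tee stemUp 7 19 ∷ tee stemUp 9 19 ∷ tee stemDown 0 18 ∷ tee stemDown 2 18 ∷ tee stemDown 4 18 ∷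
   tee stemDown 6 18 ∷ tee stemUp 11 18 ∷ tee stemRight 8 18 ∷ tee stemUp 0 16 ∷
   tee stemRight 2 17 ∷ tee stemDown 5 16 ∷ tee stemDown 7 16 ∷ tee stemRight 10 17 ∷
   tee stemUp 8 15 ∷ tee stemDown 0 14 ∷ tee stemLeft 2 15 ∷ tee stemRight 5 15 ∷
   tee stemLeft 10 15 ∷ tee stemDown 2 13 ∷ tee stemDown 4 13 ∷ tee stemUp 7 13 ∷ tee stemUp 9 13 ∷
   tee stemUp 11 13 ∷ tee stemUp 0 12 ∷ tee stemDown 6 12 ∷ tee stemUp 2 11 ∷ tee stemUp 4 11 ∷
   tee stemRight 8 12 ∷ tee stemDown 11 11 ∷ tee stemDown 0 10 ∷ tee stemUp 6 10 ∷
   tee stemDown 2 9 ∷ tee stemDown 4 9 ∷ tee stemLeft 8 10 ∷ tee stemUp 11 9 ∷ tee stemUp 0 8 ∷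
   tee stemUp 5 8 ∷ tee stemUp 7 8 ∷ tee stemRight 9 9 ∷ mono 0 8 ∷ mono 2 8 ∷ [])
  (↭-bySorting refl)

tiling13×[27+16k] : ∀ k → Tiling 13 (27 + k * 16) 3
tiling13×[27+16k] = periodicTilings strip13 19
  (tee stemDown 0 24 ∷ tee stemLeft 1 25 ∷ mono 4 26 ∷ tee stemUp 4 24 ∷ tee stemDown 6 24 ∷
   tee stemLeft 7 25 ∷ tee stemLeft 10 25 ∷ tee stemRight 2 24 ∷ tee stemUp 8 23 ∷
   tee stemDown 10 23 ∷ mono 12 25 ∷ tee stemRight 0 23 ∷ tee stemDown 7 22 ∷ tee stemUp 11 22 ∷
   tee stemDown 3 21 ∷ tee stemLeft 4 22 ∷ tee stemLeft 0 21 ∷ tee stemRight 5 21 ∷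
   tee stemLeft 8 21 ∷ tee stemDown 11 20 ∷ tee stemDown 0 19 ∷ tee stemDown 2 19 ∷
   tee stemDown 4 19 ∷ tee stemUp 7 19 ∷ tee stemUp 9 19 ∷ tee stemUp 5 18 ∷ tee stemUp 11 18 ∷
   tee stemRight 0 18 ∷ tee stemDown 3 17 ∷ tee stemDown 7 17 ∷ tee stemDown 9 17 ∷
   tee stemDown 5 16 ∷ tee stemRight 10 17 ∷ tee stemLeft 0 16 ∷ tee stemUp 3 15 ∷
   tee stemRight 7 16 ∷ tee stemDown 0 14 ∷ tee stemDown 2 14 ∷ tee stemUp 5 14 ∷
   tee stemLeft 10 15 ∷ tee stemLeft 7 14 ∷ tee stemUp 9 13 ∷ tee stemUp 11 13 ∷
   tee stemRight 0 13 ∷ tee stemLeft 3 13 ∷ tee stemRight 6 13 ∷ tee stemDown 3 11 ∷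
   tee stemDown 5 11 ∷ tee stemRight 8 12 ∷ tee stemDown 11 11 ∷ tee stemLeft 0 11 ∷
   tee stemUp 6 10 ∷ tee stemDown 0 9 ∷ tee stemDown 2 9 ∷ tee stemDown 4 9 ∷ tee stemLeft 8 10 ∷
   tee stemUp 11 9 ∷ tee stemUp 5 8 ∷ tee stemUp 7 8 ∷ tee stemRight 9 9 ∷ tee stemRight 0 8 ∷ [])
  (↭-bySorting refl)

tiling13×[31+16k] : ∀ k → Tiling 13 (31 + k * 16) 3
tiling13×[31+16k] = periodicTilings strip13 23
  (tee stemDown 0 28 ∷ tee stemLeft 1 29 ∷ tee stemDown 4 28 ∷ mono 5 30 ∷ tee stemLeft 6 29 ∷
   tee stemRight 8 29 ∷ tee stemLeft 10 29 ∷ tee stemUp 2 27 ∷ tee stemRight 5 28 ∷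
   tee stemUp 11 27 ∷ tee stemUp 0 26 ∷ tee stemLeft 8 27 ∷ tee stemDown 2 25 ∷ tee stemDown 4 25 ∷
   tee stemLeft 5 26 ∷ tee stemUp 7 25 ∷ tee stemUp 9 25 ∷ tee stemDown 11 25 ∷ tee stemDown 0 24 ∷
   tee stemRight 2 24 ∷ tee stemLeft 5 24 ∷ tee stemRight 8 24 ∷ tee stemUp 11 23 ∷
   tee stemRight 0 23 ∷ tee stemUp 4 22 ∷ tee stemUp 6 22 ∷ tee stemDown 3 21 ∷ tee stemLeft 8 22 ∷
   tee stemDown 11 21 ∷ tee stemLeft 0 21 ∷ tee stemUp 5 20 ∷ tee stemUp 7 20 ∷ tee stemUp 9 20 ∷
   tee stemDown 0 19 ∷ tee stemDown 2 19 ∷ tee stemDown 4 19 ∷ tee stemUp 11 19 ∷ tee stemUp 6 18 ∷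
   tee stemRight 8 19 ∷ tee stemUp 0 17 ∷ tee stemUp 2 17 ∷ tee stemUp 4 17 ∷ tee stemDown 11 17 ∷
   tee stemDown 6 16 ∷ tee stemLeft 8 17 ∷ mono 0 17 ∷ tee stemUp 1 15 ∷ tee stemUp 3 15 ∷
   tee stemUp 7 15 ∷ tee stemUp 9 15 ∷ tee stemUp 11 15 ∷ tee stemDown 0 14 ∷ tee stemDown 5 14 ∷
   tee stemRight 2 14 ∷ tee stemUp 6 13 ∷ tee stemUp 8 13 ∷ tee stemRight 10 14 ∷
   tee stemRight 0 13 ∷ tee stemDown 3 11 ∷ tee stemLeft 4 12 ∷ tee stemRight 7 12 ∷
   tee stemLeft 10 12 ∷ tee stemLeft 0 11 ∷ tee stemRight 5 11 ∷ tee stemUp 9 10 ∷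
   tee stemUp 11 10 ∷ tee stemDown 0 9 ∷ tee stemDown 2 9 ∷ tee stemDown 4 9 ∷ tee stemRight 7 10 ∷
   tee stemUp 5 8 ∷ tee stemRight 10 9 ∷ tee stemRight 0 8 ∷ tee stemLeft 7 8 ∷ [])
  (↭-bySorting refl)

tiling13×[35+16k] : ∀ k → Tiling 13 (35 + k * 16) 3
tiling13×[35+16k] = periodicTilings strip13 27
  (tee stemDown 0 32 ∷ mono 1 34 ∷ tee stemDown 2 32 ∷ tee stemLeft 3 33 ∷ tee stemLeft 6 33 ∷
   tee stemRight 8 33 ∷ tee stemLeft 10 33 ∷ tee stemUp 4 31 ∷ tee stemDown 6 31 ∷
   tee stemUp 11 31 ∷ tee stemRight 0 31 ∷ tee stemDown 3 30 ∷ tee stemUp 7 30 ∷ tee stemDown 9 30 ∷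
   mono 10 32 ∷ tee stemRight 10 30 ∷ tee stemLeft 0 29 ∷ tee stemLeft 4 29 ∷ tee stemRight 6 29 ∷
   tee stemDown 0 27 ∷ tee stemLeft 2 28 ∷ tee stemRight 8 28 ∷ tee stemLeft 10 28 ∷
   tee stemRight 1 27 ∷ tee stemLeft 4 27 ∷ tee stemUp 6 26 ∷ tee stemUp 11 26 ∷ tee stemDown 4 25 ∷
   tee stemLeft 8 26 ∷ tee stemDown 0 24 ∷ tee stemLeft 1 25 ∷ tee stemUp 5 24 ∷ tee stemUp 7 24 ∷
   tee stemUp 9 24 ∷ tee stemDown 11 24 ∷ tee stemRight 2 24 ∷ tee stemRight 0 23 ∷
   tee stemUp 4 22 ∷ tee stemUp 6 22 ∷ tee stemRight 8 23 ∷ tee stemUp 11 22 ∷ tee stemDown 3 21 ∷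
   tee stemLeft 0 21 ∷ tee stemRight 5 21 ∷ tee stemLeft 8 21 ∷ tee stemDown 11 20 ∷
   tee stemDown 0 19 ∷ tee stemDown 2 19 ∷ tee stemDown 4 19 ∷ tee stemUp 7 19 ∷ tee stemUp 9 19 ∷
   tee stemUp 5 18 ∷ tee stemUp 11 18 ∷ tee stemRight 0 18 ∷ tee stemDown 3 17 ∷ tee stemDown 7 17 ∷
   tee stemDown 9 17 ∷ tee stemDown 5 16 ∷ tee stemRight 10 17 ∷ tee stemLeft 0 16 ∷
   tee stemUp 3 15 ∷ tee stemRight 7 16 ∷ tee stemDown 0 14 ∷ tee stemDown 2 14 ∷ tee stemUp 5 14 ∷
   tee stemLeft 10 15 ∷ tee stemLeft 7 14 ∷ tee stemUp 9 13 ∷ tee stemUp 11 13 ∷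
   tee stemRight 0 13 ∷ tee stemLeft 3 13 ∷ tee stemRight 6 13 ∷ tee stemDown 3 11 ∷
   tee stemDown 5 11 ∷ tee stemRight 8 12 ∷ tee stemDown 11 11 ∷ tee stemLeft 0 11 ∷
   tee stemUp 6 10 ∷ tee stemDown 0 9 ∷ tee stemDown 2 9 ∷ tee stemDown 4 9 ∷ tee stemLeft 8 10 ∷
   tee stemUp 11 9 ∷ tee stemUp 5 8 ∷ tee stemUp 7 8 ∷ tee stemRight 9 9 ∷ tee stemRight 0 8 ∷ [])
  (↭-bySorting refl)

tiling13×[39+16k] : ∀ k → Tiling 13 (39 + k * 16) 3
tiling13×[39+16k] = periodicTilings strip13 31
  (tee stemDown 0 36 ∷ mono 1 38 ∷ tee stemDown 2 36 ∷ tee stemLeft 3 37 ∷ tee stemLeft 6 37 ∷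
   tee stemRight 8 37 ∷ tee stemLeft 10 37 ∷ tee stemUp 4 35 ∷ tee stemDown 6 35 ∷
   tee stemUp 11 35 ∷ tee stemUp 0 34 ∷ tee stemUp 2 34 ∷ tee stemLeft 8 35 ∷ tee stemDown 4 33 ∷
   tee stemUp 6 33 ∷ tee stemDown 8 33 ∷ mono 10 35 ∷ tee stemDown 11 33 ∷ tee stemDown 0 32 ∷
   tee stemDown 2 32 ∷ tee stemUp 9 32 ∷ tee stemUp 4 31 ∷ tee stemDown 6 31 ∷ tee stemUp 11 31 ∷
   tee stemRight 0 31 ∷ tee stemDown 3 30 ∷ tee stemUp 7 30 ∷ tee stemDown 9 30 ∷
   tee stemRight 10 30 ∷ tee stemLeft 0 29 ∷ tee stemLeft 4 29 ∷ tee stemRight 6 29 ∷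
   tee stemDown 0 27 ∷ tee stemLeft 2 28 ∷ tee stemRight 8 28 ∷ tee stemLeft 10 28 ∷
   tee stemRight 1 27 ∷ tee stemLeft 4 27 ∷ tee stemUp 6 26 ∷ tee stemUp 11 26 ∷ tee stemDown 4 25 ∷
   tee stemLeft 8 26 ∷ tee stemDown 0 24 ∷ tee stemLeft 1 25 ∷ tee stemUp 5 24 ∷ tee stemUp 7 24 ∷
   tee stemUp 9 24 ∷ tee stemDown 11 24 ∷ tee stemRight 2 24 ∷ tee stemRight 0 23 ∷
   tee stemUp 4 22 ∷ tee stemUp 6 22 ∷ tee stemRight 8 23 ∷ tee stemUp 11 22 ∷ tee stemDown 3 21 ∷
   tee stemLeft 0 21 ∷ tee stemRight 5 21 ∷ tee stemLeft 8 21 ∷ tee stemDown 11 20 ∷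
   tee stemDown 0 19 ∷ tee stemDown 2 19 ∷ tee stemDown 4 19 ∷ tee stemUp 7 19 ∷ tee stemUp 9 19 ∷
   tee stemUp 5 18 ∷ tee stemUp 11 18 ∷ tee stemRight 0 18 ∷ tee stemDown 3 17 ∷ tee stemDown 7 17 ∷
   tee stemDown 9 17 ∷ tee stemDown 5 16 ∷ tee stemRight 10 17 ∷ tee stemLeft 0 16 ∷
   tee stemUp 3 15 ∷ tee stemRight 7 16 ∷ tee stemDown 0 14 ∷ tee stemDown 2 14 ∷ tee stemUp 5 14 ∷
   tee stemLeft 10 15 ∷ tee stemLeft 7 14 ∷ tee stemUp 9 13 ∷ tee stemUp 11 13 ∷
   tee stemRight 0 13 ∷ tee stemLeft 3 13 ∷ tee stemRight 6 13 ∷ tee stemDown 3 11 ∷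
   tee stemDown 5 11 ∷ tee stemRight 8 12 ∷ tee stemDown 11 11 ∷ tee stemLeft 0 11 ∷
   tee stemUp 6 10 ∷ tee stemDown 0 9 ∷ tee stemDown 2 9 ∷ tee stemDown 4 9 ∷ tee stemLeft 8 10 ∷
   tee stemUp 11 9 ∷ tee stemUp 5 8 ∷ tee stemUp 7 8 ∷ tee stemRight 9 9 ∷ tee stemRight 0 8 ∷ [])
  (↭-bySorting refl)

tiling15×4 : Tiling 15 4 4
tiling15×4 = tilingOf
  (mono 0 0 ∷ mono 0 1 ∷ mono 0 2 ∷ tee stemLeft 0 2 ∷ mono 1 0 ∷ tee stemLeft 1 0 ∷
   tee stemRight 2 2 ∷ tee stemRight 3 0 ∷ tee stemLeft 4 2 ∷ tee stemLeft 5 0 ∷ tee stemRight 6 2 ∷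
   tee stemRight 7 0 ∷ tee stemLeft 8 2 ∷ tee stemLeft 9 0 ∷ tee stemRight 10 2 ∷
   tee stemRight 11 0 ∷ tee stemLeft 12 2 ∷ tee stemUp 13 0 ∷ [])
  refl

tiling15×8 : Tiling 15 8 4
tiling15×8 = tilingOf
  (tee stemDown 0 0 ∷ tee stemLeft 0 2 ∷ tee stemRight 0 4 ∷ tee stemDown 0 5 ∷ tee stemRight 1 0 ∷
   tee stemLeft 1 6 ∷ tee stemUp 2 1 ∷ tee stemUp 2 4 ∷ tee stemRight 4 0 ∷ tee stemDown 4 1 ∷
   tee stemRight 4 4 ∷ tee stemDown 4 5 ∷ tee stemLeft 5 2 ∷ tee stemLeft 5 6 ∷ tee stemUp 6 0 ∷
   tee stemUp 6 4 ∷ tee stemRight 8 0 ∷ tee stemDown 8 1 ∷ tee stemRight 8 4 ∷ tee stemDown 8 5 ∷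
   tee stemLeft 9 2 ∷ tee stemLeft 9 6 ∷ mono 10 1 ∷ mono 10 5 ∷ tee stemDown 11 0 ∷
   tee stemDown 11 4 ∷ tee stemRight 12 0 ∷ tee stemDown 12 2 ∷ mono 12 6 ∷ tee stemLeft 12 6 ∷
   tee stemUp 13 1 ∷ mono 13 4 ∷ tee stemUp 13 4 ∷ [])
  refl

strip15 : PeriodicStrip 15 4 16
strip15 = record
  { left           = tee stemDown 0 0 ∷ tee stemRight 1 0 ∷ mono 4 0 ∷ tee stemUp 4 0 ∷
                     tee stemDown 6 0 ∷ tee stemRight 7 0 ∷ tee stemDown 10 0 ∷ tee stemRight 11 0 ∷
                     tee stemUp 13 0 ∷ tee stemLeft 2 1 ∷ tee stemUp 8 1 ∷ tee stemLeft 0 2 ∷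
                     tee stemDown 7 2 ∷ mono 11 2 ∷ tee stemUp 11 2 ∷ tee stemDown 13 2 ∷
                     tee stemDown 3 3 ∷ tee stemRight 4 3 ∷ tee stemLeft 9 3 ∷ []
  ; brick          = tee stemRight 0 4 ∷ tee stemUp 5 4 ∷ tee stemUp 7 4 ∷ tee stemUp 13 4 ∷
                     tee stemDown 0 5 ∷ tee stemDown 2 5 ∷ tee stemDown 4 5 ∷ tee stemRight 9 5 ∷
                     tee stemUp 11 5 ∷ tee stemUp 6 6 ∷ tee stemLeft 8 6 ∷ tee stemDown 13 6 ∷
                     tee stemUp 0 7 ∷ tee stemUp 2 7 ∷ tee stemUp 4 7 ∷ tee stemDown 11 7 ∷
                     tee stemDown 6 8 ∷ tee stemRight 8 8 ∷ tee stemUp 13 8 ∷ tee stemDown 0 9 ∷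
                     tee stemDown 2 9 ∷ tee stemDown 4 9 ∷ tee stemUp 7 9 ∷ tee stemUp 9 9 ∷
                     tee stemUp 11 9 ∷ tee stemDown 13 10 ∷ tee stemUp 0 11 ∷ tee stemLeft 2 11 ∷
                     tee stemRight 5 11 ∷ tee stemUp 8 11 ∷ tee stemLeft 10 11 ∷ tee stemDown 5 12 ∷
                     tee stemDown 7 12 ∷ tee stemUp 13 12 ∷ tee stemDown 0 13 ∷ tee stemRight 2 13 ∷
                     tee stemRight 10 13 ∷ tee stemLeft 1 14 ∷ tee stemDown 4 14 ∷
                     tee stemDown 6 14 ∷ tee stemRight 8 14 ∷ tee stemUp 11 14 ∷
                     tee stemDown 13 14 ∷ tee stemUp 7 15 ∷ tee stemUp 9 15 ∷ tee stemDown 0 16 ∷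
                     tee stemRight 1 16 ∷ tee stemLeft 4 16 ∷ tee stemDown 11 16 ∷
                     tee stemUp 13 16 ∷ tee stemLeft 2 17 ∷ tee stemLeft 6 17 ∷ tee stemDown 9 17 ∷
                     tee stemLeft 0 18 ∷ tee stemUp 4 18 ∷ tee stemUp 11 18 ∷ tee stemDown 13 18 ∷
                     tee stemDown 3 19 ∷ tee stemRight 6 19 ∷ tee stemLeft 9 19 ∷ []
  ; overhang       = (7 , 4) ∷ (12 , 4) ∷ (13 , 4) ∷ (3 , 4) ∷ (3 , 5) ∷ (4 , 4) ∷ (5 , 4) ∷
                     (9 , 4) ∷ (10 , 4) ∷ (11 , 4) ∷ []
  ; left-covers    = ↭-bySorting refl
  ; brick-covers   = ↭-bySorting refl
  ; brick-monoFree = refl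
  }

tiling15×[12+16k] : ∀ k → Tiling 15 (12 + k * 16) 4
tiling15×[12+16k] = periodicTilings strip15 8
  (tee stemDown 0 9 ∷ tee stemLeft 1 10 ∷ tee stemLeft 4 10 ∷ tee stemRight 6 10 ∷
   tee stemLeft 8 10 ∷ tee stemRight 10 10 ∷ tee stemLeft 12 10 ∷ tee stemRight 2 9 ∷ mono 4 10 ∷
   tee stemUp 13 8 ∷ tee stemUp 0 7 ∷ tee stemDown 5 7 ∷ tee stemLeft 6 8 ∷ tee stemRight 8 8 ∷
   tee stemLeft 10 8 ∷ tee stemLeft 2 7 ∷ tee stemUp 11 6 ∷ tee stemDown 13 6 ∷ tee stemDown 0 5 ∷
   tee stemDown 2 5 ∷ tee stemDown 4 5 ∷ tee stemLeft 6 6 ∷ tee stemDown 9 5 ∷ mono 10 7 ∷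
   tee stemUp 5 4 ∷ tee stemUp 7 4 ∷ tee stemRight 10 5 ∷ tee stemUp 13 4 ∷ tee stemRight 0 4 ∷ [])
  (↭-bySorting refl)

tiling15×[16+16k] : ∀ k → Tiling 15 (16 + k * 16) 4
tiling15×[16+16k] = periodicTilings strip15 12
  (tee stemDown 0 13 ∷ tee stemLeft 1 14 ∷ tee stemLeft 4 14 ∷ tee stemRight 6 14 ∷
   tee stemLeft 8 14 ∷ tee stemRight 10 14 ∷ tee stemLeft 12 14 ∷ tee stemUp 2 12 ∷
   tee stemDown 4 12 ∷ tee stemUp 13 12 ∷ tee stemUp 0 11 ∷ tee stemLeft 6 12 ∷ tee stemRight 8 12 ∷
   tee stemLeft 10 12 ∷ tee stemDown 2 10 ∷ tee stemUp 4 10 ∷ tee stemDown 6 10 ∷ tee stemUp 11 10 ∷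
   tee stemDown 13 10 ∷ tee stemDown 0 9 ∷ tee stemLeft 8 10 ∷ tee stemRight 2 9 ∷ mono 4 10 ∷
   tee stemUp 6 8 ∷ tee stemDown 8 8 ∷ mono 10 10 ∷ tee stemDown 11 8 ∷ tee stemUp 13 8 ∷
   tee stemUp 0 7 ∷ tee stemDown 5 7 ∷ tee stemUp 9 7 ∷ tee stemLeft 2 7 ∷ tee stemUp 11 6 ∷
   tee stemDown 13 6 ∷ tee stemDown 0 5 ∷ tee stemDown 2 5 ∷ tee stemDown 4 5 ∷ tee stemLeft 6 6 ∷
   tee stemDown 9 5 ∷ tee stemUp 5 4 ∷ tee stemUp 7 4 ∷ tee stemRight 10 5 ∷ tee stemUp 13 4 ∷
   tee stemRight 0 4 ∷ [])
  (↭-bySorting refl)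

tiling15×[20+16k] : ∀ k → Tiling 15 (20 + k * 16) 4
tiling15×[20+16k] = periodicTilings strip15 16
  (tee stemDown 0 17 ∷ mono 1 19 ∷ tee stemLeft 2 18 ∷ tee stemUp 4 17 ∷ tee stemDown 6 17 ∷
   tee stemLeft 7 18 ∷ mono 10 19 ∷ tee stemRight 10 18 ∷ tee stemLeft 12 18 ∷ tee stemRight 1 17 ∷
   tee stemUp 8 16 ∷ tee stemUp 13 16 ∷ tee stemDown 4 15 ∷ tee stemDown 7 15 ∷ tee stemLeft 10 16 ∷
   tee stemDown 0 14 ∷ tee stemLeft 1 15 ∷ tee stemUp 5 14 ∷ tee stemUp 9 14 ∷ tee stemUp 11 14 ∷
   tee stemDown 13 14 ∷ tee stemRight 2 14 ∷ tee stemDown 8 13 ∷ tee stemRight 0 13 ∷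
   tee stemUp 4 12 ∷ tee stemUp 6 12 ∷ tee stemRight 10 13 ∷ tee stemUp 13 12 ∷ tee stemDown 3 11 ∷
   tee stemUp 8 11 ∷ tee stemLeft 0 11 ∷ tee stemRight 5 11 ∷ tee stemLeft 10 11 ∷
   tee stemDown 13 10 ∷ tee stemDown 0 9 ∷ tee stemDown 2 9 ∷ tee stemDown 4 9 ∷ tee stemUp 7 9 ∷
   tee stemUp 9 9 ∷ tee stemUp 11 9 ∷ tee stemDown 6 8 ∷ tee stemUp 13 8 ∷ tee stemUp 0 7 ∷
   tee stemUp 2 7 ∷ tee stemUp 4 7 ∷ tee stemRight 8 8 ∷ tee stemDown 11 7 ∷ tee stemUp 6 6 ∷
   tee stemDown 13 6 ∷ tee stemDown 0 5 ∷ tee stemDown 2 5 ∷ tee stemDown 4 5 ∷ tee stemLeft 8 6 ∷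
   tee stemUp 11 5 ∷ tee stemUp 5 4 ∷ tee stemUp 7 4 ∷ tee stemRight 9 5 ∷ tee stemUp 13 4 ∷
   tee stemRight 0 4 ∷ [])
  (↭-bySorting refl)

tiling15×[24+16k] : ∀ k → Tiling 15 (24 + k * 16) 4
tiling15×[24+16k] = periodicTilings strip15 20
  (tee stemDown 0 21 ∷ mono 1 23 ∷ tee stemDown 2 21 ∷ tee stemLeft 3 22 ∷ tee stemDown 6 21 ∷
   tee stemLeft 7 22 ∷ tee stemUp 9 21 ∷ tee stemDown 11 21 ∷ tee stemLeft 12 22 ∷ tee stemUp 4 20 ∷
   tee stemUp 13 20 ∷ tee stemUp 0 19 ∷ tee stemRight 2 20 ∷ tee stemUp 6 19 ∷ tee stemDown 8 19 ∷
   mono 9 21 ∷ tee stemUp 11 19 ∷ tee stemRight 9 19 ∷ tee stemDown 13 18 ∷ tee stemDown 0 17 ∷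
   tee stemLeft 2 18 ∷ tee stemUp 4 17 ∷ tee stemDown 6 17 ∷ tee stemRight 1 17 ∷ tee stemUp 7 16 ∷
   tee stemLeft 9 17 ∷ tee stemUp 11 16 ∷ tee stemUp 13 16 ∷ tee stemDown 4 15 ∷ tee stemDown 9 15 ∷
   tee stemDown 0 14 ∷ tee stemLeft 1 15 ∷ tee stemUp 5 14 ∷ tee stemDown 7 14 ∷ tee stemUp 10 14 ∷
   tee stemRight 12 15 ∷ tee stemRight 2 14 ∷ tee stemRight 0 13 ∷ tee stemUp 4 12 ∷
   tee stemLeft 8 13 ∷ tee stemLeft 12 13 ∷ tee stemDown 3 11 ∷ tee stemLeft 6 12 ∷
   tee stemLeft 10 12 ∷ tee stemUp 13 11 ∷ tee stemLeft 0 11 ∷ tee stemRight 5 11 ∷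
   tee stemLeft 8 11 ∷ tee stemUp 11 10 ∷ tee stemDown 0 9 ∷ tee stemDown 2 9 ∷ tee stemDown 4 9 ∷
   tee stemUp 7 9 ∷ tee stemUp 9 9 ∷ tee stemDown 13 9 ∷ tee stemDown 6 8 ∷ tee stemDown 11 8 ∷
   tee stemUp 0 7 ∷ tee stemUp 2 7 ∷ tee stemUp 4 7 ∷ tee stemRight 8 8 ∷ tee stemUp 13 7 ∷
   tee stemUp 6 6 ∷ tee stemRight 11 7 ∷ tee stemDown 0 5 ∷ tee stemDown 2 5 ∷ tee stemDown 4 5 ∷
   tee stemLeft 8 6 ∷ tee stemUp 5 4 ∷ tee stemUp 7 4 ∷ tee stemRight 9 5 ∷ tee stemLeft 11 5 ∷
   tee stemUp 13 4 ∷ tee stemRight 0 4 ∷ [])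
  (↭-bySorting refl)

tiling15×[15+16k] : ∀ k → Tiling 15 (15 + k * 16) 5
tiling15×[15+16k] = periodicTilings strip15 11
  (tee stemDown 0 12 ∷ mono 1 14 ∷ tee stemLeft 2 13 ∷ tee stemUp 4 12 ∷ tee stemDown 6 12 ∷
   tee stemLeft 7 13 ∷ tee stemDown 10 12 ∷ tee stemLeft 11 13 ∷ tee stemUp 13 12 ∷
   tee stemRight 1 12 ∷ tee stemUp 8 11 ∷ tee stemDown 4 10 ∷ tee stemRight 6 11 ∷
   tee stemRight 10 11 ∷ mono 12 12 ∷ tee stemDown 13 10 ∷ tee stemDown 0 9 ∷ tee stemLeft 1 10 ∷
   tee stemRight 2 9 ∷ tee stemDown 5 8 ∷ tee stemLeft 6 9 ∷ tee stemRight 8 9 ∷ tee stemLeft 10 9 ∷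
   tee stemUp 13 8 ∷ tee stemUp 0 7 ∷ tee stemUp 11 7 ∷ tee stemLeft 2 7 ∷ tee stemUp 5 6 ∷
   tee stemDown 7 6 ∷ tee stemLeft 8 7 ∷ tee stemDown 13 6 ∷ tee stemDown 0 5 ∷ tee stemDown 2 5 ∷
   tee stemDown 4 5 ∷ tee stemUp 9 5 ∷ tee stemDown 11 5 ∷ tee stemDown 8 4 ∷ tee stemUp 13 4 ∷
   tee stemRight 0 4 ∷ tee stemLeft 5 4 ∷ mono 12 5 ∷ [])
  (↭-bySorting refl)

tiling15×[19+16k] : ∀ k → Tiling 15 (19 + k * 16) 5
tiling15×[19+16k] = periodicTilings strip15 15
  (mono 0 18 ∷ tee stemUp 0 16 ∷ tee stemDown 2 16 ∷ tee stemLeft 3 17 ∷ tee stemDown 6 16 ∷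
   tee stemLeft 7 17 ∷ tee stemUp 9 16 ∷ tee stemDown 11 16 ∷ tee stemLeft 12 17 ∷ tee stemUp 4 15 ∷
   tee stemUp 13 15 ∷ tee stemDown 0 14 ∷ tee stemRight 2 15 ∷ mono 7 16 ∷ tee stemUp 7 14 ∷
   tee stemDown 9 14 ∷ tee stemRight 11 15 ∷ tee stemRight 5 14 ∷ tee stemUp 0 12 ∷
   tee stemLeft 2 13 ∷ tee stemRight 9 13 ∷ tee stemLeft 11 13 ∷ tee stemUp 13 12 ∷
   tee stemDown 2 11 ∷ tee stemDown 4 11 ∷ tee stemLeft 5 12 ∷ tee stemUp 7 11 ∷ tee stemDown 0 10 ∷
   tee stemLeft 9 11 ∷ tee stemUp 11 10 ∷ tee stemDown 13 10 ∷ tee stemRight 2 10 ∷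
   tee stemLeft 5 10 ∷ tee stemRight 8 10 ∷ tee stemRight 0 9 ∷ tee stemUp 4 8 ∷ tee stemRight 6 9 ∷
   tee stemRight 10 9 ∷ tee stemUp 13 8 ∷ tee stemDown 3 7 ∷ tee stemUp 8 7 ∷ tee stemLeft 0 7 ∷
   tee stemUp 5 6 ∷ tee stemDown 7 6 ∷ tee stemLeft 10 7 ∷ tee stemDown 13 6 ∷ tee stemDown 0 5 ∷
   tee stemDown 2 5 ∷ tee stemDown 4 5 ∷ tee stemUp 9 5 ∷ tee stemUp 11 5 ∷ tee stemDown 8 4 ∷
   tee stemUp 13 4 ∷ tee stemRight 0 4 ∷ tee stemLeft 5 4 ∷ mono 11 5 ∷ [])
  (↭-bySorting refl)

tiling15×[23+16k] : ∀ k → Tiling 15 (23 + k * 16) 5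
tiling15×[23+16k] = periodicTilings strip15 19
  (mono 0 22 ∷ tee stemUp 0 20 ∷ tee stemDown 2 20 ∷ tee stemLeft 3 21 ∷ tee stemRight 5 21 ∷
   tee stemLeft 7 21 ∷ tee stemUp 9 20 ∷ tee stemDown 11 20 ∷ tee stemLeft 12 21 ∷
   tee stemUp 13 19 ∷ tee stemDown 0 18 ∷ tee stemUp 2 18 ∷ tee stemDown 4 18 ∷ tee stemLeft 5 19 ∷
   tee stemUp 7 18 ∷ tee stemDown 9 18 ∷ tee stemUp 11 18 ∷ tee stemDown 13 17 ∷ tee stemUp 0 16 ∷
   tee stemDown 2 16 ∷ tee stemRight 4 17 ∷ mono 6 18 ∷ tee stemDown 7 16 ∷ tee stemUp 9 16 ∷
   tee stemDown 11 16 ∷ tee stemUp 13 15 ∷ tee stemDown 0 14 ∷ tee stemRight 2 15 ∷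
   tee stemLeft 4 15 ∷ tee stemUp 7 14 ∷ tee stemDown 9 14 ∷ tee stemRight 11 15 ∷
   tee stemRight 5 14 ∷ tee stemUp 0 12 ∷ tee stemLeft 2 13 ∷ tee stemRight 9 13 ∷
   tee stemLeft 11 13 ∷ tee stemUp 13 12 ∷ tee stemDown 2 11 ∷ tee stemDown 4 11 ∷
   tee stemLeft 5 12 ∷ tee stemUp 7 11 ∷ tee stemDown 0 10 ∷ tee stemLeft 9 11 ∷ tee stemUp 11 10 ∷
   tee stemDown 13 10 ∷ tee stemRight 2 10 ∷ tee stemLeft 5 10 ∷ tee stemRight 8 10 ∷
   tee stemRight 0 9 ∷ tee stemUp 4 8 ∷ tee stemRight 6 9 ∷ tee stemRight 10 9 ∷ tee stemUp 13 8 ∷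
   tee stemDown 3 7 ∷ tee stemUp 8 7 ∷ tee stemLeft 0 7 ∷ tee stemUp 5 6 ∷ tee stemDown 7 6 ∷
   tee stemLeft 10 7 ∷ tee stemDown 13 6 ∷ tee stemDown 0 5 ∷ tee stemDown 2 5 ∷ tee stemDown 4 5 ∷
   tee stemUp 9 5 ∷ tee stemUp 11 5 ∷ tee stemDown 8 4 ∷ tee stemUp 13 4 ∷ tee stemRight 0 4 ∷
   tee stemLeft 5 4 ∷ mono 11 5 ∷ [])
  (↭-bySorting refl)

tiling15×[27+16k] : ∀ k → Tiling 15 (27 + k * 16) 5
tiling15×[27+16k] = periodicTilings strip15 23
  (mono 0 26 ∷ tee stemUp 0 24 ∷ tee stemDown 2 24 ∷ tee stemLeft 3 25 ∷ tee stemDown 6 24 ∷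
   tee stemLeft 7 25 ∷ tee stemUp 9 24 ∷ tee stemDown 11 24 ∷ tee stemLeft 12 25 ∷ tee stemUp 4 23 ∷
   tee stemUp 13 23 ∷ tee stemDown 0 22 ∷ tee stemRight 2 23 ∷ mono 7 24 ∷ tee stemUp 7 22 ∷
   tee stemDown 9 22 ∷ tee stemRight 11 23 ∷ tee stemRight 5 22 ∷ tee stemUp 0 20 ∷
   tee stemLeft 2 21 ∷ tee stemRight 9 21 ∷ tee stemLeft 11 21 ∷ tee stemUp 13 20 ∷
   tee stemDown 2 19 ∷ tee stemDown 4 19 ∷ tee stemLeft 5 20 ∷ tee stemUp 7 19 ∷ tee stemDown 0 18 ∷
   tee stemLeft 9 19 ∷ tee stemUp 11 18 ∷ tee stemDown 13 18 ∷ tee stemRight 2 18 ∷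
   tee stemLeft 5 18 ∷ tee stemRight 8 18 ∷ tee stemUp 0 16 ∷ tee stemDown 5 16 ∷
   tee stemDown 7 16 ∷ tee stemRight 10 17 ∷ tee stemUp 13 16 ∷ tee stemLeft 2 16 ∷
   tee stemUp 8 15 ∷ tee stemDown 0 14 ∷ tee stemDown 2 14 ∷ tee stemDown 4 14 ∷ tee stemDown 6 14 ∷
   tee stemLeft 10 15 ∷ tee stemDown 13 14 ∷ tee stemUp 7 13 ∷ tee stemUp 9 13 ∷ tee stemUp 11 13 ∷
   tee stemRight 0 13 ∷ tee stemDown 3 12 ∷ tee stemDown 5 12 ∷ tee stemUp 13 12 ∷ tee stemUp 6 11 ∷
   tee stemRight 8 12 ∷ tee stemDown 11 11 ∷ tee stemLeft 0 11 ∷ tee stemRight 3 11 ∷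
   tee stemDown 13 10 ∷ tee stemDown 0 9 ∷ tee stemDown 2 9 ∷ tee stemRight 5 10 ∷
   tee stemLeft 8 10 ∷ tee stemUp 11 9 ∷ tee stemDown 4 8 ∷ tee stemUp 7 8 ∷ tee stemUp 9 8 ∷
   tee stemUp 13 8 ∷ tee stemUp 0 7 ∷ tee stemUp 2 7 ∷ tee stemRight 5 8 ∷ tee stemDown 11 7 ∷
   tee stemDown 9 6 ∷ tee stemDown 13 6 ∷ tee stemDown 0 5 ∷ tee stemDown 2 5 ∷ tee stemDown 4 5 ∷
   tee stemLeft 5 6 ∷ tee stemUp 7 5 ∷ tee stemUp 11 5 ∷ tee stemRight 9 5 ∷ tee stemUp 13 4 ∷
   tee stemRight 0 4 ∷ tee stemLeft 5 4 ∷ mono 8 4 ∷ [])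
  (↭-bySorting refl)

tiling6×4a : ∀ a → Tiling 6 (a * 4) 4
tiling6×4a 0                   = weaken z≤n (tilingOf [] refl)
tiling6×4a 1                   = tiling6×4
tiling6×4a 2                   = tiling6×8
tiling6×4a (suc (suc (suc a))) = tiling6×[12+4b] a

tiling13×4a : ∀ a → Tiling 13 (a * 4) 4
tiling13×4a a = byResidue (mod4 a)
  where
  byResidue : ∀ {a} → Mod4 a → Tiling 13 (a * 4) 4
  byResidue (quad 0)             = weaken z≤n (tilingOf [] refl)
  byResidue (quad 1)             = tiling13×16
  byResidue (quad (suc (suc k))) = widthByQuads 32 k (tiling13×[32+16k] k)
  byResidue (quad+1 0)           = tiling13×4
  byResidue (quad+1 (suc k))     = widthByQuads 20 k (tiling13×[20+16k] k)
  byResidue (quad+2 0)           = tiling13×8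
  byResidue (quad+2 (suc k))     = widthByQuads 24 k (tiling13×[24+16k] k)
  byResidue (quad+3 0)           = tiling13×12
  byResidue (quad+3 (suc k))     = widthByQuads 28 k (tiling13×[28+16k] k)

tiling13×[13+4b] : ∀ b → Tiling 13 (13 + b * 4) 5
tiling13×[13+4b] b = byResidue (mod4 b)
  where
  byResidue : ∀ {b} → Mod4 b → Tiling 13 (13 + b * 4) 5
  byResidue (quad 0)         = tiling13×13
  byResidue (quad (suc k))   = widthByQuads 29 k (tiling13×[29+16k] k)
  byResidue (quad+1 0)       = tiling13×17
  byResidue (quad+1 (suc k)) = widthByQuads 33 k (tiling13×[33+16k] k)
  byResidue (quad+2 k)       = widthByQuads 21 k (tiling13×[21+16k] k)
  byResidue (quad+3 k)       = widthByQuads 25 k (tiling13×[25+16k] k)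

tiling13×[15+4b] : ∀ b → Tiling 13 (15 + b * 4) 3
tiling13×[15+4b] b = byResidue (mod4 b)
  where
  byResidue : ∀ {b} → Mod4 b → Tiling 13 (15 + b * 4) 3
  byResidue (quad 0)         = tiling13×15
  byResidue (quad (suc k))   = widthByQuads 31 k (tiling13×[31+16k] k)
  byResidue (quad+1 0)       = tiling13×19
  byResidue (quad+1 (suc k)) = widthByQuads 35 k (tiling13×[35+16k] k)
  byResidue (quad+2 0)       = tiling13×23
  byResidue (quad+2 (suc k)) = widthByQuads 39 k (tiling13×[39+16k] k)
  byResidue (quad+3 k)       = widthByQuads 27 k (tiling13×[27+16k] k)

tiling15×4a : ∀ a → Tiling 15 (a * 4) 4
tiling15×4a a = byResidue (mod4 a)
  where
  byResidue : ∀ {a} → Mod4 a → Tiling 15 (a * 4) 4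
  byResidue (quad 0)         = weaken z≤n (tilingOf [] refl)
  byResidue (quad (suc k))   = widthByQuads 16 k (tiling15×[16+16k] k)
  byResidue (quad+1 0)       = tiling15×4
  byResidue (quad+1 (suc k)) = widthByQuads 20 k (tiling15×[20+16k] k)
  byResidue (quad+2 0)       = tiling15×8
  byResidue (quad+2 (suc k)) = widthByQuads 24 k (tiling15×[24+16k] k)
  byResidue (quad+3 k)       = widthByQuads 12 k (tiling15×[12+16k] k)

tiling15×[15+4b] : ∀ b → Tiling 15 (15 + b * 4) 5
tiling15×[15+4b] b = byResidue (mod4 b)
  where
  byResidue : ∀ {b} → Mod4 b → Tiling 15 (15 + b * 4) 5
  byResidue (quad k)   = widthByQuads 15 k (tiling15×[15+16k] k)
  byResidue (quad+1 k) = widthByQuads 19 k (tiling15×[19+16k] k)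
  byResidue (quad+2 k) = widthByQuads 23 k (tiling15×[23+16k] k)
  byResidue (quad+3 k) = widthByQuads 27 k (tiling15×[27+16k] k)

tiling[12+4a]×[13+4b] : ∀ a b → Tiling (12 + a * 4) (13 + b * 4) 4
tiling[12+4a]×[13+4b] a b = beside-quadBlocks tiling13×4a (3 + a) b

tiling[12+4a]×[14+4b] : ∀ a b → Tiling (12 + a * 4) (14 + b * 4) 4
tiling[12+4a]×[14+4b] a b = beside-quadBlocks tiling6×4a (3 + a) (2 + b)

tiling[12+4a]×[15+4b] : ∀ a b → Tiling (12 + a * 4) (15 + b * 4) 4
tiling[12+4a]×[15+4b] a b = beside-quadBlocks tiling15×4a (3 + a) b

tiling[13+4a]×[13+4b] : ∀ a b → Tiling (13 + a * 4) (13 + b * 4) 9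
tiling[13+4a]×[13+4b] a b = stack (tiling13×[13+4b] b) (beside-quadBlocks tiling13×4a a b)

tiling[13+4a]×[14+4b] : ∀ a b → Tiling (13 + a * 4) (14 + b * 4) 6
tiling[13+4a]×[14+4b] a b = transpose (stack (tiling6×[13+4b] a) (beside-quadBlocks tiling13×4a (2 + b) a))

tiling[13+4a]×[15+4b] : ∀ a b → Tiling (13 + a * 4) (15 + b * 4) 7
tiling[13+4a]×[15+4b] a b = stack (tiling13×[15+4b] b) (beside-quadBlocks tiling15×4a a b)

tiling[14+4a]×[14+4b] : ∀ a b → Tiling (14 + a * 4) (14 + b * 4) 8
tiling[14+4a]×[14+4b] a b = stack (tiling6×[14+4b] b) (beside-quadBlocks tiling6×4a (2 + a) (2 + b))

tiling[14+4a]×[15+4b] : ∀ a b → Tiling (14 + a * 4) (15 + b * 4) 6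
tiling[14+4a]×[15+4b] a b = stack (tiling6×[15+4b] b) (beside-quadBlocks tiling15×4a (2 + a) b)

tiling[15+4a]×[15+4b] : ∀ a b → Tiling (15 + a * 4) (15 + b * 4) 9
tiling[15+4a]×[15+4b] a b = stack (tiling15×[15+4b] b) (beside-quadBlocks tiling15×4a a b)

gapAtMost9 : ∀ {m n c} → Tiling m n c → {True (c ≤? 9)} → GapAtMost m n 9
gapAtMost9 {m} {n} T {c≤9} =
  pieces T , ↭-trans (covers T) (↭-reflexive (sym (rectangle≡block m n)))
           , ≤-trans (fewMonos T) (toWitness c≤9)

gapAtMost9-byResidues : ∀ {i j} → Mod4 i → Mod4 j → GapAtMost (12 + i) (12 + j) 9
gapAtMost9-byResidues (quad a)   (quad b)   = gapAtMost9 (quadBlocks (3 + a) (3 + b))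
gapAtMost9-byResidues (quad a)   (quad+1 b) = gapAtMost9 (tiling[12+4a]×[13+4b] a b)
gapAtMost9-byResidues (quad a)   (quad+2 b) = gapAtMost9 (tiling[12+4a]×[14+4b] a b)
gapAtMost9-byResidues (quad a)   (quad+3 b) = gapAtMost9 (tiling[12+4a]×[15+4b] a b)
gapAtMost9-byResidues (quad+1 a) (quad b)   = gapAtMost9 (transpose (tiling[12+4a]×[13+4b] b a))
gapAtMost9-byResidues (quad+1 a) (quad+1 b) = gapAtMost9 (tiling[13+4a]×[13+4b] a b)
gapAtMost9-byResidues (quad+1 a) (quad+2 b) = gapAtMost9 (tiling[13+4a]×[14+4b] a b)
gapAtMost9-byResidues (quad+1 a) (quad+3 b) = gapAtMost9 (tiling[13+4a]×[15+4b] a b)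
gapAtMost9-byResidues (quad+2 a) (quad b)   = gapAtMost9 (transpose (tiling[12+4a]×[14+4b] b a))
gapAtMost9-byResidues (quad+2 a) (quad+1 b) = gapAtMost9 (transpose (tiling[13+4a]×[14+4b] b a))
gapAtMost9-byResidues (quad+2 a) (quad+2 b) = gapAtMost9 (tiling[14+4a]×[14+4b] a b)
gapAtMost9-byResidues (quad+2 a) (quad+3 b) = gapAtMost9 (tiling[14+4a]×[15+4b] a b)
gapAtMost9-byResidues (quad+3 a) (quad b)   = gapAtMost9 (transpose (tiling[12+4a]×[15+4b] b a))
gapAtMost9-byResidues (quad+3 a) (quad+1 b) = gapAtMost9 (transpose (tiling[13+4a]×[15+4b] b a))
gapAtMost9-byResidues (quad+3 a) (quad+2 b) = gapAtMost9 (transpose (tiling[14+4a]×[15+4b] b a))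
gapAtMost9-byResidues (quad+3 a) (quad+3 b) = gapAtMost9 (tiling[15+4a]×[15+4b] a b)

theorem6 : (m n : ℕ) → 12 ≤ m → 12 ≤ n → GapAtMost m n 9
theorem6 m n 12≤m 12≤n =
  subst₂ (λ m n → GapAtMost m n 9) (m+[n∸m]≡n 12≤m) (m+[n∸m]≡n 12≤n)
    (gapAtMost9-byResidues (mod4 (m ∸ 12)) (mod4 (n ∸ 12)))
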